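{- Let $H$ be a canonical 2-edge cover of a graph $G$. Then $\mathrm{cost}(H)\le\frac54|H|$.
   Context: $|H|$ denotes the number of edges of $H$. A 2-edge cover of $G$ is a spanning subgraph in which every vertex has degree at least 2. $\mathcal C_i$ denotes a cycle on $i$ vertices. A component of $H$ is complex if it contains a bridge; blocks are maximal 2-edge-connected subgraphs of $H$; a block $B$ of a complex component $C$ is pendant if $C\setminus V(B)$ is connected, otherwise non-pendant. $H$ is canonical if each non-complex component is a $\mathcal C_i$ with $4\le i\le 7$ or has at least 8 edges, and in each complex component every pendant block has at least 6 edges and every non-pendant block at least 4 edges. Credits: each 2-edge-connected component $C$ of $H$ that is a $\mathcal C_i$, $4\le i\le7$, gets credit $\frac14|E(C)|$; each 2-edge-connected component with at least 8 edges gets credit 2; in each complex component, every block gets credit 1, every bridge gets credit $\frac14$, and the complex component itself gets an additional credit 1. $\mathrm{credit}(H)$ is the total credit and $\mathrm{cost}(H)=|H|+\mathrm{credit}(H)$. -}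

module Defs where

open import Data.Bool using (Bool; true; false; _∧_; _∨_; not; if_then_else_)
open import Data.Nat as ℕ using (ℕ; zero; suc; _≤ᵇ_; _<ᵇ_; _≡ᵇ_)
open import Data.Fin using (Fin; toℕ; _≟_)
open import Data.List using (List; []; _∷_; map; allFin; _++_)
open import Data.Bool.ListAction using (any; all)
open import Data.Nat.ListAction using (sum)
open import Data.Vec using (Vec; lookup)
import Data.Vec as Vec
open import Data.Integer using (+_)
open import Data.Rational using (ℚ; _+_; _/_; 0ℚ; 1ℚ)
open import Relation.Nullary.Decidable using (⌊_⌋)
open import Relation.Binary.PropositionalEquality using (_≡_)
open import Data.Product using (_×_)
open import Data.Sum using (_⊎_)

Adj : ℕ → Set
Adj n = Fin n → Fin n → Bool

record SimpleGraph (n : ℕ) : Set where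
  field
    adj    : Adj n
    sym    : ∀ i j → adj i j ≡ adj j i
    irrefl : ∀ i → adj i i ≡ false
open SimpleGraph public

VSet : ℕ → Set
VSet n = Vec Bool n

_∈ᵇ_ : ∀ {n} → Fin n → VSet n → Bool
v ∈ᵇ S = lookup S v

allSubsets : ∀ n → List (VSet n)
allSubsets zero    = Vec.[] ∷ []
allSubsets (suc n) = map (true Vec.∷_) (allSubsets n) ++ map (false Vec.∷_) (allSubsets n)

fullSet : ∀ {n} → VSet n
fullSet = Vec.replicate _ true

_∖_ : ∀ {n} → VSet n → VSet n → VSet n
S ∖ T = Vec.zipWith (λ a b → a ∧ not b) S T

anyF : ∀ {n} → (Fin n → Bool) → Bool
anyF {n} p = any p (allFin n)

allF : ∀ {n} → (Fin n → Bool) → Bool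
allF {n} p = all p (allFin n)

countF : ∀ {n} → (Fin n → Bool) → ℕ
countF {n} p = sum (map (λ i → if p i then 1 else 0) (allFin n))

eqF : ∀ {n} → Fin n → Fin n → Bool
eqF a b = ⌊ a ≟ b ⌋

-- quantification / counting over unordered pairs {a,b} (taken as a < b)
countPairs : ∀ {n} → (Fin n → Fin n → Bool) → ℕ
countPairs {n} p = sum (map (λ a → countF (λ b → (toℕ a <ᵇ toℕ b) ∧ p a b)) (allFin n))

anyPair : ∀ {n} → (Fin n → Fin n → Bool) → Bool
anyPair p = anyF λ a → anyF λ b → (toℕ a <ᵇ toℕ b) ∧ p a b

allPair : ∀ {n} → (Fin n → Fin n → Bool) → Bool
allPair p = allF λ a → allF λ b → not (toℕ a <ᵇ toℕ b) ∨ p a b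

induced : ∀ {n} → Adj n → VSet n → Adj n
induced A S i j = (i ∈ᵇ S) ∧ (j ∈ᵇ S) ∧ A i j

delEdge : ∀ {n} → Adj n → Fin n → Fin n → Adj n
delEdge A a b i j = A i j ∧ not ((eqF i a ∧ eqF j b) ∨ (eqF i b ∧ eqF j a))

edgesIn : ∀ {n} → Adj n → VSet n → ℕ
edgesIn A S = countPairs (induced A S)

numEdges : ∀ {n} → Adj n → ℕ
numEdges A = edgesIn A fullSet

size : ∀ {n} → VSet n → ℕ
size S = countF (_∈ᵇ S)

degree : ∀ {n} → Adj n → Fin n → ℕ
degree A v = countF (A v)

nonempty : ∀ {n} → VSet n → Bool
nonempty S = anyF (_∈ᵇ S)

subsetᵇ : ∀ {n} → VSet n → VSet n → Bool
subsetᵇ S T = allF λ v → not (v ∈ᵇ S) ∨ (v ∈ᵇ T)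

-- reachability: the set of vertices reachable from u by a walk of
-- length ≤ k (a walk in a graph on n vertices can be shortened to length < n)
reachIter : ∀ {n} → Adj n → ℕ → (Fin n → Bool) → (Fin n → Bool)
reachIter A zero    R = R
reachIter A (suc k) R = reachIter A k (λ v → R v ∨ anyF (λ w → R w ∧ A w v))

reach : ∀ {n} → Adj n → Fin n → Fin n → Bool
reach {n} A u = reachIter A n (eqF u)

connectedOn : ∀ {n} → Adj n → VSet n → Bool
connectedOn A S = nonempty S ∧
  (allF λ u → allF λ v → not ((u ∈ᵇ S) ∧ (v ∈ᵇ S)) ∨ reach (induced A S) u v)

twoEdgeConnectedOn : ∀ {n} → Adj n → VSet n → Bool
twoEdgeConnectedOn A S = connectedOn A S ∧
  allPair (λ a b → not (induced A S a b) ∨ connectedOn (delEdge A a b) S)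

isComponent : ∀ {n} → Adj n → VSet n → Bool
isComponent A S = connectedOn A S ∧
  (allF λ u → allF λ v → not ((u ∈ᵇ S) ∧ not (v ∈ᵇ S) ∧ A u v))

isBridge : ∀ {n} → Adj n → Fin n → Fin n → Bool
isBridge A a b = A a b ∧ not (reach (delEdge A a b) a b)

bridgeIn : ∀ {n} → Adj n → VSet n → Fin n → Fin n → Bool
bridgeIn A C a b = (a ∈ᵇ C) ∧ (b ∈ᵇ C) ∧ isBridge A a b

numBridges : ∀ {n} → Adj n → VSet n → ℕ
numBridges A C = countPairs (bridgeIn A C)

isComplex : ∀ {n} → Adj n → VSet n → Bool
isComplex A C = anyPair (bridgeIn A C)

-- A maximal 2-edge-connected
-- subgraph contains all edges of A between its vertices, so it is
-- determined by its vertex set B: A[B] is 2-edge-connected and no proper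
-- superset of B induces a 2-edge-connected subgraph.
isBlock : ∀ {n} → Adj n → VSet n → Bool
isBlock {n} A B = twoEdgeConnectedOn A B ∧
  not (any (λ T → subsetᵇ B T ∧ not (subsetᵇ T B) ∧ twoEdgeConnectedOn A T) (allSubsets n))

isBlockOf : ∀ {n} → Adj n → VSet n → VSet n → Bool
isBlockOf A C B = isBlock A B ∧ subsetᵇ B C

isPendant : ∀ {n} → Adj n → VSet n → VSet n → Bool
isPendant A C B = connectedOn A (C ∖ B)

numBlocks : ∀ {n} → Adj n → VSet n → ℕ
numBlocks {n} A C = sum (map (λ B → if isBlockOf A C B then 1 else 0) (allSubsets n))

isCycleOn : ∀ {n} → Adj n → VSet n → Bool
isCycleOn A S = connectedOn A S ∧
  (allF λ v → not (v ∈ᵇ S) ∨ (degree (induced A S) v ≡ᵇ 2))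

isShortCycle : ∀ {n} → Adj n → VSet n → Bool
isShortCycle A S = isCycleOn A S ∧ (4 ≤ᵇ size S) ∧ (size S ≤ᵇ 7)

IsSpanningSubgraph : ∀ {n} → SimpleGraph n → SimpleGraph n → Set
IsSpanningSubgraph H G = ∀ i j → adj H i j ≡ true → adj G i j ≡ true

Is2EdgeCover : ∀ {n} → SimpleGraph n → SimpleGraph n → Set
Is2EdgeCover H G = IsSpanningSubgraph H G × (∀ v → 2 ℕ.≤ degree (adj H) v)

IsCanonical : ∀ {n} → SimpleGraph n → Set
IsCanonical {n} H = (C : VSet n) → isComponent (adj H) C ≡ true →
  (isComplex (adj H) C ≡ false →
     isShortCycle (adj H) C ≡ true ⊎ 8 ℕ.≤ edgesIn (adj H) C)
  × (isComplex (adj H) C ≡ true → (B : VSet n) → isBlockOf (adj H) C B ≡ true →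
     (isPendant (adj H) C B ≡ true → 6 ℕ.≤ edgesIn (adj H) B)
     × (isPendant (adj H) C B ≡ false → 4 ℕ.≤ edgesIn (adj H) B))

ℕtoℚ : ℕ → ℚ
ℕtoℚ k = + k / 1

sumℚ : List ℚ → ℚ
sumℚ []       = 0ℚ
sumℚ (x ∷ xs) = x + sumℚ xs

componentCredit : ∀ {n} → Adj n → VSet n → ℚ
componentCredit A C =
  if isComplex A C
  then ℕtoℚ (numBlocks A C) + (+ numBridges A C / 4) + 1ℚ
  else (if isShortCycle A C then + edgesIn A C / 4
        else (if 8 ≤ᵇ edgesIn A C then ℕtoℚ 2 else 0ℚ))

credit : ∀ {n} → SimpleGraph n → ℚ
credit {n} H =
  sumℚ (map (λ C → if isComponent (adj H) C then componentCredit (adj H) C else 0ℚ)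
            (allSubsets n))

cost : ∀ {n} → SimpleGraph n → ℚ
cost H = ℕtoℚ (numEdges (adj H)) + credit H

module Submission where

-- All credits are multiples of ¼, so it suffices to show 4·credit(C) ≤ |E(C)| for every component C
-- and to add up over the edge-disjoint components.  This is immediate for cycles and for large
-- 2-edge-connected components.  A complex component earns 4·(#blocks) + #bridges + 4 quarters.  Its
-- blocks are vertex-disjoint and contain no bridge, so |E(C)| ≥ Σ_B |E(B)| + #bridges, and every block
-- has at least 4 edges.  The remaining 4 quarters come from two distinct pendant blocks with at least
-- 6 edges each: beyond either end of a bridge, passing repeatedly to a bridge with a strictly smaller
-- side ends at a bridgeless side, which is a pendant block.

open import Data.Bool using (Bool; true; false; _∧_; _∨_; not; if_then_else_)
open import Data.Bool.ListAction using (any; all)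
open import Data.Bool.Properties using (¬-not; ∨-comm; ∧-comm; T-≡; if-float; if-cong-then; if-cong-else; if-cong₂)
open import Data.Empty using (⊥; ⊥-elim)
open import Data.Fin using (Fin; toℕ) renaming (_≟_ to _≟ᶠ_)
open import Data.Fin.Properties using (toℕ-injective)
import Data.Integer as ℤ
import Data.Integer.Properties as ℤ
open import Data.List using (List; []; _∷_; map; allFin; _++_; length)
open import Data.List.Properties using (length-tabulate)
open import Data.List.Membership.Propositional using (_∈_)
open import Data.List.Membership.Propositional.Properties using (∈-allFin; ∈-map⁺; ∈-++⁺ˡ; ∈-++⁺ʳ)
open import Data.List.Relation.Unary.Any using (here; there)
open import Data.Nat using (ℕ; zero; suc; _+_; _*_; _≤_; _<_; z≤n; s≤s; _<ᵇ_; _≤ᵇ_)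
open import Data.Nat.Properties
open import Data.Nat.ListAction using (sum)
open import Data.Nat.Tactic.RingSolver using (solve-∀)
open import Data.Integer.Tactic.RingSolver using () renaming (solve-∀ to ℤ-solve-∀)
open import Data.Product using (Σ-syntax; _×_; _,_; proj₁; proj₂)
import Data.Rational as ℚ
open import Data.Rational using (ℚ; toℚᵘ)
open import Data.Rational.Properties using (toℚᵘ-injective; toℚᵘ-homo-+; toℚᵘ-homo-*; toℚᵘ-fromℚᵘ; toℚᵘ-cancel-≤)
import Data.Rational.Properties as ℚ
import Data.Rational.Unnormalised as ℚᵘ
import Data.Rational.Unnormalised.Properties as ℚᵘ
open import Data.Sum using (_⊎_; inj₁; inj₂; [_,_]′)
open import Data.Vec using (lookup; zipWith; tabulate; tail) renaming ([] to []ᵛ; _∷_ to _∷ᵛ_)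
open import Data.Vec.Properties using (lookup-zipWith; lookup∘tabulate; lookup-replicate; tabulate∘lookup; tabulate-cong)
open import Function using (_∘_)
open import Function.Bundles using (Equivalence)
open import Relation.Binary using (tri<; tri≈; tri>)
open import Relation.Binary.PropositionalEquality
open import Relation.Nullary.Decidable using (isYes≗does; dec-true; toWitness)

open import Defs hiding (sym)

quarters : ℕ → ℚ
quarters k = ℤ.+ k ℚ./ 4

toℚᵘ-quarters : ∀ k → toℚᵘ (quarters k) ℚᵘ.≃ ℚᵘ.mkℚᵘ (ℤ.+ k) 3
toℚᵘ-quarters k = toℚᵘ-fromℚᵘ (ℚᵘ.mkℚᵘ (ℤ.+ k) 3)

toℚᵘ-ℕtoℚ : ∀ k → toℚᵘ (ℕtoℚ k) ℚᵘ.≃ ℚᵘ.mkℚᵘ (ℤ.+ k) 0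
toℚᵘ-ℕtoℚ k = toℚᵘ-fromℚᵘ (ℚᵘ.mkℚᵘ (ℤ.+ k) 0)

mkℚᵘ-cross : ∀ {a b} d e → a * suc e ≡ b * suc d → ℚᵘ.mkℚᵘ (ℤ.+ a) d ℚᵘ.≃ ℚᵘ.mkℚᵘ (ℤ.+ b) e
mkℚᵘ-cross {a} {b} d e eq =
  ℚᵘ.*≡* (trans (sym (ℤ.pos-* a (suc e))) (trans (cong ℤ.+_ eq) (ℤ.pos-* b (suc d))))

quarters-+ : ∀ a b → quarters a ℚ.+ quarters b ≡ quarters (a + b)
quarters-+ a b = toℚᵘ-injective (begin
  toℚᵘ (quarters a ℚ.+ quarters b)           ≈⟨ toℚᵘ-homo-+ (quarters a) (quarters b) ⟩
  toℚᵘ (quarters a) ℚᵘ.+ toℚᵘ (quarters b)   ≈⟨ ℚᵘ.+-cong (toℚᵘ-quarters a) (toℚᵘ-quarters b) ⟩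
  ℚᵘ.mkℚᵘ (ℤ.+ a) 3 ℚᵘ.+ ℚᵘ.mkℚᵘ (ℤ.+ b) 3   ≈⟨ ℚᵘ.*≡* cross-multiplied ⟩
  ℚᵘ.mkℚᵘ (ℤ.+ (a + b)) 3                    ≈⟨ ℚᵘ.≃-sym (toℚᵘ-quarters (a + b)) ⟩
  toℚᵘ (quarters (a + b))                    ∎)
  where
  open ℚᵘ.≃-Reasoning
  cross : ∀ (x y : ℤ.ℤ) → (x ℤ.* ℤ.+ 4 ℤ.+ y ℤ.* ℤ.+ 4) ℤ.* ℤ.+ 4 ≡ (x ℤ.+ y) ℤ.* ℤ.+ 16
  cross = ℤ-solve-∀
  cross-multiplied : (ℤ.+ a ℤ.* ℤ.+ 4 ℤ.+ ℤ.+ b ℤ.* ℤ.+ 4) ℤ.* ℤ.+ 4 ≡ ℤ.+ (a + b) ℤ.* ℤ.+ 16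
  cross-multiplied = trans (cross (ℤ.+ a) (ℤ.+ b)) (cong (ℤ._* ℤ.+ 16) (sym (ℤ.pos-+ a b)))

ℕtoℚ≡quarters : ∀ a → ℕtoℚ a ≡ quarters (4 * a)
ℕtoℚ≡quarters a = toℚᵘ-injective (begin
  toℚᵘ (ℕtoℚ a)             ≈⟨ toℚᵘ-ℕtoℚ a ⟩
  ℚᵘ.mkℚᵘ (ℤ.+ a) 0         ≈⟨ mkℚᵘ-cross 0 3 (trans (*-comm a 4) (sym (*-identityʳ (4 * a)))) ⟩
  ℚᵘ.mkℚᵘ (ℤ.+ (4 * a)) 3   ≈⟨ ℚᵘ.≃-sym (toℚᵘ-quarters (4 * a)) ⟩
  toℚᵘ (quarters (4 * a))   ∎)
  where open ℚᵘ.≃-Reasoning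

five-quarters-* : ∀ e → (ℤ.+ 5 ℚ./ 4) ℚ.* ℕtoℚ e ≡ quarters (5 * e)
five-quarters-* e = toℚᵘ-injective (begin
  toℚᵘ ((ℤ.+ 5 ℚ./ 4) ℚ.* ℕtoℚ e)        ≈⟨ toℚᵘ-homo-* (ℤ.+ 5 ℚ./ 4) (ℕtoℚ e) ⟩
  toℚᵘ (quarters 5) ℚᵘ.* toℚᵘ (ℕtoℚ e)   ≈⟨ ℚᵘ.*-cong (toℚᵘ-quarters 5) (toℚᵘ-ℕtoℚ e) ⟩
  ℚᵘ.mkℚᵘ (ℤ.+ 5 ℤ.* ℤ.+ e) 3            ≡⟨ cong (λ z → ℚᵘ.mkℚᵘ z 3) (sym (ℤ.pos-* 5 e)) ⟩
  ℚᵘ.mkℚᵘ (ℤ.+ (5 * e)) 3                ≈⟨ ℚᵘ.≃-sym (toℚᵘ-quarters (5 * e)) ⟩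
  toℚᵘ (quarters (5 * e))                ∎)
  where open ℚᵘ.≃-Reasoning

quarters-mono-≤ : ∀ {a b} → a ≤ b → quarters a ℚ.≤ quarters b
quarters-mono-≤ {a} {b} a≤b = toℚᵘ-cancel-≤ (begin
  toℚᵘ (quarters a)   ≃⟨ toℚᵘ-quarters a ⟩
  ℚᵘ.mkℚᵘ (ℤ.+ a) 3   ≤⟨ ℚᵘ.*≤* (ℤ.*-monoʳ-≤-nonNeg (ℤ.+ 4) (ℤ.+≤+ a≤b)) ⟩
  ℚᵘ.mkℚᵘ (ℤ.+ b) 3   ≃⟨ ℚᵘ.≃-sym (toℚᵘ-quarters b) ⟩
  toℚᵘ (quarters b)   ∎)
  where open ℚᵘ.≤-Reasoning

∧-trueˡ : ∀ {a b} → a ∧ b ≡ true → a ≡ true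
∧-trueˡ {true} _ = refl

∧-trueʳ : ∀ {a b} → a ∧ b ≡ true → b ≡ true
∧-trueʳ {true} b≡true = b≡true

∧-true : ∀ {a b} → a ≡ true → b ≡ true → a ∧ b ≡ true
∧-true refl refl = refl

∨-true⁻ : ∀ {a b} → a ∨ b ≡ true → a ≡ true ⊎ b ≡ true
∨-true⁻ {true}  _ = inj₁ refl
∨-true⁻ {false} b≡true = inj₂ b≡true

∨-trueˡ : ∀ {a b} → a ≡ true → a ∨ b ≡ true
∨-trueˡ refl = refl

∨-trueʳ : ∀ {a b} → b ≡ true → a ∨ b ≡ true
∨-trueʳ {true}  _ = refl
∨-trueʳ {false} b≡true = b≡true

not-true⁻ : ∀ {a} → not a ≡ true → a ≡ false
not-true⁻ {false} _ = refl

not-true : ∀ {a} → a ≡ false → not a ≡ true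
not-true refl = refl

true⇒≢false : ∀ {a} → a ≡ true → a ≢ false
true⇒≢false refl ()

true-or-false : ∀ b → b ≡ true ⊎ b ≡ false
true-or-false true  = inj₁ refl
true-or-false false = inj₂ refl

≡-if-iff : ∀ {a b} → (a ≡ true → b ≡ true) → (b ≡ true → a ≡ true) → a ≡ b
≡-if-iff {true}          a⇒b _ = sym (a⇒b refl)
≡-if-iff {false} {true}  _ b⇒a = b⇒a refl
≡-if-iff {false} {false} _ _   = refl

if-true : ∀ {X : Set} {b} {x y : X} → b ≡ true → (if b then x else y) ≡ x
if-true refl = refl

if-false : ∀ {X : Set} {b} {x y : X} → b ≡ false → (if b then x else y) ≡ y
if-false refl = refl

module _ {A : Set} (p : A → Bool) where

  any⁺ : ∀ {x} xs → x ∈ xs → p x ≡ true → any p xs ≡ true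
  any⁺ (y ∷ ys) (here refl) px = ∨-trueˡ px
  any⁺ (y ∷ ys) (there x∈ys) px = ∨-trueʳ {p y} (any⁺ ys x∈ys px)

  any⁻ : ∀ xs → any p xs ≡ true → Σ[ x ∈ A ] p x ≡ true
  any⁻ (y ∷ ys) any≡true with ∨-true⁻ {p y} any≡true
  ... | inj₁ py = y , py
  ... | inj₂ rest = any⁻ ys rest

  all⁺ : ∀ xs → (∀ x → p x ≡ true) → all p xs ≡ true
  all⁺ []       _  = refl
  all⁺ (y ∷ ys) ∀p = ∧-true (∀p y) (all⁺ ys ∀p)

  all⁻ : ∀ {x} xs → all p xs ≡ true → x ∈ xs → p x ≡ true
  all⁻ (y ∷ ys) all≡true (here refl)  = ∧-trueˡ all≡true
  all⁻ (y ∷ ys) all≡true (there x∈ys) = all⁻ ys (∧-trueʳ {p y} all≡true) x∈ys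

module _ {n : ℕ} (p : Fin n → Bool) where

  anyF⁺ : ∀ i → p i ≡ true → anyF p ≡ true
  anyF⁺ i = any⁺ p (allFin n) (∈-allFin i)

  anyF⁻ : anyF p ≡ true → Σ[ i ∈ Fin n ] p i ≡ true
  anyF⁻ = any⁻ p (allFin n)

  allF⁺ : (∀ i → p i ≡ true) → allF p ≡ true
  allF⁺ = all⁺ p (allFin n)

  allF⁻ : allF p ≡ true → ∀ i → p i ≡ true
  allF⁻ all≡true i = all⁻ p (allFin n) all≡true (∈-allFin i)

  allF-false⁻ : allF p ≡ false → Σ[ i ∈ Fin n ] p i ≡ false
  allF-false⁻ all≡false with true-or-false (anyF (λ i → not (p i)))
  ... | inj₁ some = let i , ¬pi = any⁻ (λ i → not (p i)) (allFin n) some in i , not-true⁻ ¬pi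
  ... | inj₂ none = ⊥-elim (true⇒≢false (allF⁺ everywhere) all≡false)
    where
    everywhere : ∀ i → p i ≡ true
    everywhere i = ¬-not λ pi≡false → true⇒≢false (any⁺ (not ∘ p) (allFin n) (∈-allFin i) (not-true pi≡false)) none

private variable
  A B : Set

∑ : List A → (A → ℕ) → ℕ
∑ xs f = sum (map f xs)

syntax ∑ xs (λ x → e) = ∑[ x ∈ xs ] e

𝟙 : Bool → ℕ
𝟙 b = if b then 1 else 0

+-+-comm : ∀ a b c d → (a + b) + (c + d) ≡ (a + c) + (b + d)
+-+-comm = solve-∀

∑-cong : ∀ xs {f g : A → ℕ} → (∀ x → f x ≡ g x) → ∑ xs f ≡ ∑ xs g
∑-cong []       _ = refl
∑-cong (x ∷ xs) f≗g = cong₂ _+_ (f≗g x) (∑-cong xs f≗g)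

∑-mono-≤ : ∀ xs {f g : A → ℕ} → (∀ x → f x ≤ g x) → ∑ xs f ≤ ∑ xs g
∑-mono-≤ []       _ = z≤n
∑-mono-≤ (x ∷ xs) f≤g = +-mono-≤ (f≤g x) (∑-mono-≤ xs f≤g)

∑-zero : ∀ xs {f : A → ℕ} → (∀ x → f x ≡ 0) → ∑ xs f ≡ 0
∑-zero []       _ = refl
∑-zero (x ∷ xs) f≡0 rewrite f≡0 x = ∑-zero xs f≡0

∑-+ : ∀ xs (f g : A → ℕ) → ∑[ x ∈ xs ] (f x + g x) ≡ ∑ xs f + ∑ xs g
∑-+ []       f g = refl
∑-+ (x ∷ xs) f g rewrite ∑-+ xs f g = +-+-comm (f x) (g x) (∑ xs f) (∑ xs g)

∑-*ˡ : ∀ xs c (f : A → ℕ) → ∑[ x ∈ xs ] (c * f x) ≡ c * ∑ xs f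
∑-*ˡ []       c f = sym (*-zeroʳ c)
∑-*ˡ (x ∷ xs) c f rewrite ∑-*ˡ xs c f = sym (*-distribˡ-+ c (f x) (∑ xs f))

∑-++ : ∀ xs ys (f : A → ℕ) → ∑ (xs ++ ys) f ≡ ∑ xs f + ∑ ys f
∑-++ []       ys f = refl
∑-++ (x ∷ xs) ys f rewrite ∑-++ xs ys f = sym (+-assoc (f x) _ _)

∑-map : ∀ xs (g : A → B) (f : B → ℕ) → ∑ (map g xs) f ≡ ∑[ x ∈ xs ] f (g x)
∑-map []       g f = refl
∑-map (x ∷ xs) g f = cong (f (g x) +_) (∑-map xs g f)

∑-comm : ∀ xs (ys : List B) (f : A → B → ℕ) →
         ∑[ x ∈ xs ] ∑[ y ∈ ys ] f x y ≡ ∑[ y ∈ ys ] ∑[ x ∈ xs ] f x y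
∑-comm []       ys f = sym (∑-zero ys (λ _ → refl))
∑-comm (x ∷ xs) ys f rewrite ∑-comm xs ys f = sym (∑-+ ys (f x) (λ y → ∑[ x ∈ xs ] f x y))

∑-const-1 : (xs : List A) → ∑[ x ∈ xs ] 1 ≡ length xs
∑-const-1 []       = refl
∑-const-1 (x ∷ xs) = cong suc (∑-const-1 xs)

∑-pos⇒witness : ∀ xs (f : A → ℕ) → 0 < ∑ xs f → Σ[ x ∈ A ] 0 < f x
∑-pos⇒witness (x ∷ xs) f 0<∑ with f x in fx≡
... | zero  = ∑-pos⇒witness xs f 0<∑
... | suc _ = x , subst (0 <_) (sym fx≡) (s≤s z≤n)

∑-mono-<-at : ∀ {x} xs {f g : A → ℕ} → (∀ x → f x ≤ g x) → x ∈ xs → f x < g x → ∑ xs f < ∑ xs g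
∑-mono-<-at (y ∷ ys) f≤g (here refl)  fx<gx = +-mono-<-≤ fx<gx (∑-mono-≤ ys f≤g)
∑-mono-<-at (y ∷ ys) f≤g (there x∈ys) fx<gx = +-mono-≤-< (f≤g y) (∑-mono-<-at ys f≤g x∈ys fx<gx)

∑-mono-≤-surplus : ∀ {x k} xs {f g : A → ℕ} → (∀ x → g x ≤ f x) → x ∈ xs → g x + k ≤ f x →
                   ∑ xs g + k ≤ ∑ xs f
∑-mono-≤-surplus {k = k} (y ∷ ys) {f} {g} g≤f (here refl) surplus = begin
  g y + ∑ ys g + k   ≡⟨ +-assoc (g y) _ k ⟩
  g y + (∑ ys g + k) ≡⟨ cong (g y +_) (+-comm (∑ ys g) k) ⟩
  g y + (k + ∑ ys g) ≡⟨ +-assoc (g y) k _ ⟨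
  g y + k + ∑ ys g   ≤⟨ +-mono-≤ surplus (∑-mono-≤ ys g≤f) ⟩
  f y + ∑ ys f       ∎
  where open ≤-Reasoning
∑-mono-≤-surplus {k = k} (y ∷ ys) {f} {g} g≤f (there x∈ys) surplus = begin
  g y + ∑ ys g + k   ≡⟨ +-assoc (g y) _ k ⟩
  g y + (∑ ys g + k) ≤⟨ +-mono-≤ (g≤f y) (∑-mono-≤-surplus ys g≤f x∈ys surplus) ⟩
  f y + ∑ ys f       ∎
  where open ≤-Reasoning

∑-mono-≤-surplus₂ : ∀ {x x′ k} xs {f g : A → ℕ} → (∀ x → g x ≤ f x) → x ≢ x′ → x ∈ xs → x′ ∈ xs →
                    g x + k ≤ f x → g x′ + k ≤ f x′ → ∑ xs g + (k + k) ≤ ∑ xs f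
∑-mono-≤-surplus₂ (y ∷ ys) g≤f x≢x′ (here refl) (here refl) _ _ = ⊥-elim (x≢x′ refl)
∑-mono-≤-surplus₂ {k = k} (y ∷ ys) {f} {g} g≤f x≢x′ (here refl) (there x′∈ys) surplus surplus′ =
  ≤-trans (≤-reflexive (+-+-comm (g y) (∑ ys g) k k))
          (+-mono-≤ surplus (∑-mono-≤-surplus ys g≤f x′∈ys surplus′))
∑-mono-≤-surplus₂ {k = k} (y ∷ ys) {f} {g} g≤f x≢x′ (there x∈ys) (here refl) surplus surplus′ =
  ≤-trans (≤-reflexive (+-+-comm (g y) (∑ ys g) k k))
          (+-mono-≤ surplus′ (∑-mono-≤-surplus ys g≤f x∈ys surplus))
∑-mono-≤-surplus₂ {k = k} (y ∷ ys) {f} {g} g≤f x≢x′ (there x∈ys) (there x′∈ys) surplus surplus′ =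
  ≤-trans (≤-reflexive (+-assoc (g y) (∑ ys g) (k + k)))
          (+-mono-≤ (g≤f y) (∑-mono-≤-surplus₂ ys g≤f x≢x′ x∈ys x′∈ys surplus surplus′))

𝟙≤1 : ∀ b → 𝟙 b ≤ 1
𝟙≤1 true  = s≤s z≤n
𝟙≤1 false = z≤n

𝟙-mono-≤ : ∀ {a b} → (a ≡ true → b ≡ true) → 𝟙 a ≤ 𝟙 b
𝟙-mono-≤ {true}  a⇒b rewrite a⇒b refl = s≤s z≤n
𝟙-mono-≤ {false} _ = z≤n

𝟙-pos⁻ : ∀ {b} → 0 < 𝟙 b → b ≡ true
𝟙-pos⁻ {true} _ = refl

∑𝟙-false : ∀ xs (P : A → Bool) → (∀ x → P x ≡ false) → ∑[ x ∈ xs ] 𝟙 (P x) ≡ 0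
∑𝟙-false xs P none = ∑-zero xs (λ x → cong 𝟙 (none x))

module _ {n : ℕ} where

  ∑-allFin-1 : ∑[ i ∈ allFin n ] 1 ≡ n
  ∑-allFin-1 = trans (∑-const-1 (allFin n)) (length-tabulate (λ i → i))

  countF≤n : (p : Fin n → Bool) → countF p ≤ n
  countF≤n p = subst (countF p ≤_) ∑-allFin-1 (∑-mono-≤ (allFin n) (λ i → 𝟙≤1 (p i)))

  countF-mono-< : (p q : Fin n → Bool) → (∀ i → p i ≡ true → q i ≡ true) →
                  ∀ i → p i ≡ false → q i ≡ true → countF p < countF q
  countF-mono-< p q p⊆q i pi≡false qi≡true =
    ∑-mono-<-at (allFin n) (λ j → 𝟙-mono-≤ (p⊆q j)) (∈-allFin i) (𝟙p<𝟙q pi≡false qi≡true)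
    where
    𝟙p<𝟙q : p i ≡ false → q i ≡ true → 𝟙 (p i) < 𝟙 (q i)
    𝟙p<𝟙q eq eq′ rewrite eq | eq′ = s≤s z≤n

  countF≥n⇒all : (p : Fin n → Bool) → n ≤ countF p → ∀ i → p i ≡ true
  countF≥n⇒all p n≤count i = ¬-not λ pi≡false →
    <⇒≱ (subst (countF p <_) ∑-allFin-1 (countF-mono-< p (λ _ → true) (λ _ _ → refl) i pi≡false refl))
        n≤count

infix 4 _⊆ᵛ_

_⊆ᵛ_ : ∀ {n} → VSet n → VSet n → Set
S ⊆ᵛ T = ∀ v → v ∈ᵇ S ≡ true → v ∈ᵇ T ≡ true

VSet-ext : ∀ {n} {S S′ : VSet n} → (∀ v → v ∈ᵇ S ≡ v ∈ᵇ S′) → S ≡ S′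
VSet-ext {S = S} {S′} S≗S′ =
  trans (sym (tabulate∘lookup S)) (trans (tabulate-cong S≗S′) (tabulate∘lookup S′))

∈-allSubsets : ∀ {n} (S : VSet n) → S ∈ allSubsets n
∈-allSubsets []ᵛ = here refl
∈-allSubsets {suc n} (true  ∷ᵛ S) = ∈-++⁺ˡ (∈-map⁺ (true ∷ᵛ_) (∈-allSubsets S))
∈-allSubsets {suc n} (false ∷ᵛ S) =
  ∈-++⁺ʳ (map (true ∷ᵛ_) (allSubsets n)) (∈-map⁺ (false ∷ᵛ_) (∈-allSubsets S))

AtMostOne : ∀ {n} → (VSet n → Bool) → Set
AtMostOne P = ∀ S S′ → P S ≡ true → P S′ ≡ true → S ≡ S′

∑-allSubsets-atMostOne : ∀ n (P : VSet n → Bool) → AtMostOne P → ∑[ S ∈ allSubsets n ] 𝟙 (P S) ≤ 1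
∑-allSubsets-atMostOne zero    P _ = ≤-trans (≤-reflexive (+-identityʳ _)) (𝟙≤1 (P []ᵛ))
∑-allSubsets-atMostOne (suc n) P unique = begin
  ∑[ S ∈ allSubsets (suc n) ] 𝟙 (P S)
    ≡⟨ ∑-++ (map (true ∷ᵛ_) (allSubsets n)) _ (𝟙 ∘ P) ⟩
  ∑ (map (true ∷ᵛ_) (allSubsets n)) (𝟙 ∘ P) + ∑ (map (false ∷ᵛ_) (allSubsets n)) (𝟙 ∘ P)
    ≡⟨ cong₂ _+_ (∑-map (allSubsets n) (true ∷ᵛ_) (𝟙 ∘ P)) (∑-map (allSubsets n) (false ∷ᵛ_) (𝟙 ∘ P)) ⟩
  ∑[ S ∈ allSubsets n ] 𝟙 (P (true ∷ᵛ S)) + ∑[ S ∈ allSubsets n ] 𝟙 (P (false ∷ᵛ S))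
    ≤⟨ bound ⟩
  1 ∎
  where
  open ≤-Reasoning
  unique-with : ∀ b → AtMostOne (λ S → P (b ∷ᵛ S))
  unique-with b S S′ PS PS′ = cong tail (unique _ _ PS PS′)
  bound : ∑[ S ∈ allSubsets n ] 𝟙 (P (true ∷ᵛ S)) + ∑[ S ∈ allSubsets n ] 𝟙 (P (false ∷ᵛ S)) ≤ 1
  bound with ∑[ S ∈ allSubsets n ] 𝟙 (P (true ∷ᵛ S)) in count≡
  ... | zero  = ∑-allSubsets-atMostOne n _ (unique-with false)
  ... | suc k =
    let S , 0<𝟙 = ∑-pos⇒witness (allSubsets n) _ (subst (0 <_) (sym count≡) (s≤s z≤n))
        none : ∀ S′ → P (false ∷ᵛ S′) ≡ false
        none S′ = ¬-not λ PS′ → true≢false-head (unique _ _ (𝟙-pos⁻ 0<𝟙) PS′)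
    in begin
      suc k + ∑[ S ∈ allSubsets n ] 𝟙 (P (false ∷ᵛ S))
        ≡⟨ cong (suc k +_) (∑𝟙-false (allSubsets n) _ none) ⟩
      suc k + 0
        ≡⟨ +-identityʳ (suc k) ⟩
      suc k
        ≤⟨ subst (_≤ 1) count≡ (∑-allSubsets-atMostOne n _ (unique-with true)) ⟩
      1 ∎
    where
    true≢false-head : ∀ {m} {S S′ : VSet m} → true ∷ᵛ S ≢ false ∷ᵛ S′
    true≢false-head ()

∑-allSubsets-atMostOne-≤ : ∀ n (P : VSet n → Bool) {q} → AtMostOne P → (∀ S → P S ≡ true → q ≡ true) →
                           ∑[ S ∈ allSubsets n ] 𝟙 (P S) ≤ 𝟙 q
∑-allSubsets-atMostOne-≤ n P {true}  unique _   = ∑-allSubsets-atMostOne n P unique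
∑-allSubsets-atMostOne-≤ n P {false} _      P⇒q =
  ≤-reflexive (∑𝟙-false (allSubsets n) P (λ S → ¬-not λ PS → true⇒≢false (P⇒q S PS) refl))

-- Reachability

module _ {n : ℕ} where

  _⊆ᴳ_ : Adj n → Adj n → Set
  G ⊆ᴳ G′ = ∀ a b → G a b ≡ true → G′ a b ≡ true

  Undirected : Adj n → Set
  Undirected G = ∀ a b → G a b ≡ G b a

  Loopless : Adj n → Set
  Loopless G = ∀ i → G i i ≡ false

  Closed : Adj n → (Fin n → Bool) → Set
  Closed G X = ∀ v w → X v ≡ true → G v w ≡ true → X w ≡ true

  leaves : Adj n → (Fin n → Bool) → Bool
  leaves G X = anyF λ v → anyF λ w → X v ∧ G v w ∧ not (X w)

  ¬leaves⇒closed : ∀ G X → leaves G X ≡ false → Closed G X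
  ¬leaves⇒closed G X ¬leaves v w Xv Gvw = ¬-not λ Xw≡false →
    true⇒≢false (anyF⁺ _ v (anyF⁺ _ w (∧-true Xv (∧-true Gvw (not-true Xw≡false))))) ¬leaves

  leaves⁻ : ∀ G X → leaves G X ≡ true → Σ[ v ∈ Fin n ] Σ[ w ∈ Fin n ] X v ≡ true × G v w ≡ true × X w ≡ false
  leaves⁻ G X leaves≡true =
    let v , fromV = anyF⁻ _ leaves≡true
        w , edgeOut = anyF⁻ _ fromV
        rest = ∧-trueʳ {X v} edgeOut
    in v , w , ∧-trueˡ edgeOut , ∧-trueˡ rest , not-true⁻ (∧-trueʳ {G v w} rest)

  step : Adj n → (Fin n → Bool) → Fin n → Bool
  step G R v = R v ∨ anyF (λ w → R w ∧ G w v)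

  step-least : ∀ G R (X : Fin n → Bool) → (∀ v → R v ≡ true → X v ≡ true) → Closed G X →
               ∀ v → step G R v ≡ true → X v ≡ true
  step-least G R X R⊆X closed v stepRv with ∨-true⁻ {R v} stepRv
  ... | inj₁ Rv = R⊆X v Rv
  ... | inj₂ viaEdge =
    let w , RwGwv = anyF⁻ _ viaEdge in closed w v (R⊆X w (∧-trueˡ RwGwv)) (∧-trueʳ {R w} RwGwv)

  reachIter-suc : ∀ G k R v → reachIter G (suc k) R v ≡ step G (reachIter G k R) v
  reachIter-suc G zero    R v = refl
  reachIter-suc G (suc k) R v = reachIter-suc G k (step G R) v

  reachIter-⊇ : ∀ G k R v → R v ≡ true → reachIter G k R v ≡ true
  reachIter-⊇ G zero    R v Rv = Rv
  reachIter-⊇ G (suc k) R v Rv = reachIter-⊇ G k (step G R) v (∨-trueˡ Rv)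

  reachIter-least : ∀ G k R (X : Fin n → Bool) → (∀ v → R v ≡ true → X v ≡ true) → Closed G X →
                    ∀ v → reachIter G k R v ≡ true → X v ≡ true
  reachIter-least G zero    R X R⊆X closed = R⊆X
  reachIter-least G (suc k) R X R⊆X closed = reachIter-least G k (step G R) X (step-least G R X R⊆X closed) closed

  step-closed-or-grows : ∀ G X → Closed G X ⊎ countF X < countF (step G X)
  step-closed-or-grows G X with true-or-false (leaves G X)
  ... | inj₂ ¬leaves     = inj₁ (¬leaves⇒closed G X ¬leaves)
  ... | inj₁ leaves≡true =
    let v , w , Xv , Gvw , ¬Xw = leaves⁻ G X leaves≡true
    in inj₂ (countF-mono-< X (step G X) (λ _ → ∨-trueˡ) w ¬Xw (∨-trueʳ {X w} (anyF⁺ _ v (∧-true Xv Gvw))))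

  reachIter-suc-closed : ∀ G k R → Closed G (reachIter G k R) → Closed G (reachIter G (suc k) R)
  reachIter-suc-closed G k R closed v w Yv Gvw =
    trans (reachIter-suc G k R w) (∨-trueˡ (closed v w Xv Gvw))
    where
    X : Fin n → Bool
    X = reachIter G k R
    Xv : X v ≡ true
    Xv = step-least G X X (λ _ Xv → Xv) closed v (trans (sym (reachIter-suc G k R v)) Yv)

  countF-reachIter-suc : ∀ G k R → countF (reachIter G (suc k) R) ≡ countF (step G (reachIter G k R))
  countF-reachIter-suc G k R = ∑-cong (allFin n) (λ i → cong 𝟙 (reachIter-suc G k R i))

  reachIter-closed-or-large : ∀ G k R → Closed G (reachIter G k R) ⊎ k ≤ countF (reachIter G k R)
  reachIter-closed-or-large G zero    R = inj₂ z≤n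
  reachIter-closed-or-large G (suc k) R with reachIter-closed-or-large G k R | step-closed-or-grows G (reachIter G k R)
  ... | inj₁ closed | _           = inj₁ (reachIter-suc-closed G k R closed)
  ... | inj₂ _      | inj₁ closed = inj₁ (reachIter-suc-closed G k R closed)
  ... | inj₂ k≤|X|  | inj₂ grows  =
    inj₂ (subst (suc k ≤_) (sym (countF-reachIter-suc G k R)) (≤-trans (s≤s k≤|X|) grows))

  -- After n rounds the set is closed: otherwise it gained a vertex in every round, so it is everything.
  reachIter-closed : ∀ G R → Closed G (reachIter G n R)
  reachIter-closed G R with reachIter-closed-or-large G n R
  ... | inj₁ closed = closed
  ... | inj₂ full   = λ _ w _ _ → countF≥n⇒all (reachIter G n R) full w

eqF-refl : ∀ {n} (u : Fin n) → eqF u u ≡ true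
eqF-refl u = trans (isYes≗does (u ≟ᶠ u)) (dec-true (u ≟ᶠ u) refl)

eqF⁻ : ∀ {n} {u v : Fin n} → eqF u v ≡ true → u ≡ v
eqF⁻ eq = toWitness (Equivalence.from T-≡ eq)

module _ {n : ℕ} (G : Adj n) where

  reach-refl : ∀ u → reach G u u ≡ true
  reach-refl u = reachIter-⊇ G n (eqF u) u (eqF-refl u)

  reach-step : ∀ {u v w} → reach G u v ≡ true → G v w ≡ true → reach G u w ≡ true
  reach-step {u} = reachIter-closed G (eqF u) _ _

  reach-least : ∀ {u v} (X : Fin n → Bool) → X u ≡ true → Closed G X → reach G u v ≡ true → X v ≡ true
  reach-least {u} {v} X Xu closed =
    reachIter-least G n (eqF u) X (λ w u≡w → subst (λ z → X z ≡ true) (eqF⁻ u≡w) Xu) closed v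

  reach-edge : ∀ {u v} → G u v ≡ true → reach G u v ≡ true
  reach-edge {u} = reach-step (reach-refl u)

  reach-trans : ∀ {u v w} → reach G u v ≡ true → reach G v w ≡ true → reach G u w ≡ true
  reach-trans {u} u↝v = reach-least (reach G u) u↝v (λ _ _ → reach-step)

  reach-sym : Undirected G → ∀ {u v} → reach G u v ≡ true → reach G v u ≡ true
  reach-sym undirected {u} = reach-least (λ x → reach G x u) (reach-refl u)
    (λ a b b↝u Gab → reach-trans (reach-edge (trans (undirected b a) Gab)) b↝u)

reach-mono : ∀ {n} {G G′ : Adj n} → G ⊆ᴳ G′ → ∀ {u v} → reach G u v ≡ true → reach G′ u v ≡ true
reach-mono {G = G} {G′} G⊆G′ {u} =
  reach-least G (reach G′ u) (reach-refl G′ u) (λ a b u↝a Gab → reach-step G′ u↝a (G⊆G′ a b Gab))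

module _ {n : ℕ} where

  subsetᵇ⁻ : ∀ (S S′ : VSet n) → subsetᵇ S S′ ≡ true → S ⊆ᵛ S′
  subsetᵇ⁻ S S′ S⊆S′ v v∈S with ∨-true⁻ (allF⁻ _ S⊆S′ v)
  ... | inj₁ v∉S  = ⊥-elim (true⇒≢false v∈S (not-true⁻ v∉S))
  ... | inj₂ v∈S′ = v∈S′

  subsetᵇ⁺ : ∀ (S S′ : VSet n) → S ⊆ᵛ S′ → subsetᵇ S S′ ≡ true
  subsetᵇ⁺ S S′ S⊆S′ = allF⁺ _ member
    where
    member : ∀ v → not (v ∈ᵇ S) ∨ (v ∈ᵇ S′) ≡ true
    member v with true-or-false (v ∈ᵇ S)
    ... | inj₁ v∈S  rewrite v∈S = S⊆S′ v v∈S
    ... | inj₂ v∉S  rewrite v∉S = refl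

  subsetᵇ-false⁻ : ∀ (S S′ : VSet n) → subsetᵇ S S′ ≡ false →
                   Σ[ v ∈ Fin n ] v ∈ᵇ S ≡ true × v ∈ᵇ S′ ≡ false
  subsetᵇ-false⁻ S S′ S⊈S′ with allF-false⁻ _ S⊈S′
  ... | v , member≡false with v ∈ᵇ S in v∈S | v ∈ᵇ S′ in v∉S′
  ... | true  | false = v , v∈S , v∉S′
  subsetᵇ-false⁻ _ _ _ | _ , () | true  | true
  subsetᵇ-false⁻ _ _ _ | _ , () | false | _

  induced⁺ : ∀ (G : Adj n) S {a b} → a ∈ᵇ S ≡ true → b ∈ᵇ S ≡ true → G a b ≡ true → induced G S a b ≡ true
  induced⁺ G S a∈S b∈S Gab = ∧-true a∈S (∧-true b∈S Gab)

  induced⁻ : ∀ (G : Adj n) S a b → induced G S a b ≡ true → a ∈ᵇ S ≡ true × b ∈ᵇ S ≡ true × G a b ≡ true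
  induced⁻ G S a b edge =
    ∧-trueˡ edge , ∧-trueˡ (∧-trueʳ {a ∈ᵇ S} edge) , ∧-trueʳ {b ∈ᵇ S} (∧-trueʳ {a ∈ᵇ S} edge)

  induced-⊆ : ∀ (G : Adj n) S → induced G S ⊆ᴳ G
  induced-⊆ G S a b edge = proj₂ (proj₂ (induced⁻ G S a b edge))

  induced-mono : ∀ {G G′ : Adj n} S → G ⊆ᴳ G′ → induced G S ⊆ᴳ induced G′ S
  induced-mono {G} {G′} S G⊆G′ a b edge =
    let a∈S , b∈S , Gab = induced⁻ G S a b edge in induced⁺ G′ S a∈S b∈S (G⊆G′ a b Gab)

  induced-monoˡ : ∀ (G : Adj n) S U → S ⊆ᵛ U → induced G S ⊆ᴳ induced G U
  induced-monoˡ G S U S⊆U a b edge =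
    let a∈S , b∈S , Gab = induced⁻ G S a b edge in induced⁺ G U (S⊆U a a∈S) (S⊆U b b∈S) Gab

  Linked : Adj n → VSet n → Set
  Linked G S = ∀ {u v} → u ∈ᵇ S ≡ true → v ∈ᵇ S ≡ true → reach G u v ≡ true

  linked-mono : ∀ {G G′ : Adj n} S → G ⊆ᴳ G′ → Linked G S → Linked G′ S
  linked-mono S G⊆G′ linked u∈S v∈S = reach-mono G⊆G′ (linked u∈S v∈S)

  reach-induced : ∀ (G : Adj n) S {u v} → (∀ w → reach G u w ≡ true → w ∈ᵇ S ≡ true) →
                  reach G u v ≡ true → reach (induced G S) u v ≡ true
  reach-induced G S {u} stays = reach-least G (reach (induced G S) u) (reach-refl _ u) closed
    where
    closed : Closed G (reach (induced G S) u)
    closed a b u↝a Gab =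
      reach-step (induced G S) u↝a (induced⁺ G S (stays a u↝ᴳa) (stays b (reach-step G u↝ᴳa Gab)) Gab)
      where u↝ᴳa = reach-mono (induced-⊆ G S) u↝a

  connected⇒nonempty : ∀ (G : Adj n) S → connectedOn G S ≡ true → Σ[ v ∈ Fin n ] v ∈ᵇ S ≡ true
  connected⇒nonempty G S connected = anyF⁻ _ (∧-trueˡ connected)

  connected⇒linked : ∀ (G : Adj n) S → connectedOn G S ≡ true → Linked (induced G S) S
  connected⇒linked G S connected {u} {v} u∈S v∈S
    with ∨-true⁻ (allF⁻ _ (allF⁻ _ (∧-trueʳ {nonempty S} connected) u) v)
  ... | inj₁ notBoth = ⊥-elim (true⇒≢false (∧-true u∈S v∈S) (not-true⁻ notBoth))
  ... | inj₂ u↝v     = u↝v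

  connectedOn⁺ : ∀ (G : Adj n) S {x} → x ∈ᵇ S ≡ true → Linked (induced G S) S → connectedOn G S ≡ true
  connectedOn⁺ G S {x} x∈S linked = ∧-true (anyF⁺ _ x x∈S) (allF⁺ _ λ u → allF⁺ _ λ v → pair u v)
    where
    pair : ∀ u v → not ((u ∈ᵇ S) ∧ (v ∈ᵇ S)) ∨ reach (induced G S) u v ≡ true
    pair u v with true-or-false (u ∈ᵇ S) | true-or-false (v ∈ᵇ S)
    ... | inj₁ u∈S | inj₁ v∈S = ∨-trueʳ (linked u∈S v∈S)
    ... | inj₂ u∉S | _        rewrite u∉S = refl
    ... | inj₁ u∈S | inj₂ v∉S rewrite u∈S | v∉S = refl

  connectedOn-mono : ∀ {G G′ : Adj n} S → G ⊆ᴳ G′ → connectedOn G S ≡ true → connectedOn G′ S ≡ true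
  connectedOn-mono {G} {G′} S G⊆G′ connected =
    let x , x∈S = connected⇒nonempty G S connected
    in connectedOn⁺ G′ S x∈S (linked-mono S (induced-mono S G⊆G′) (connected⇒linked G S connected))

  induced-undirected : ∀ (G : Adj n) S → Undirected G → Undirected (induced G S)
  induced-undirected G S undirected i j rewrite undirected i j with i ∈ᵇ S | j ∈ᵇ S
  ... | true  | true  = refl
  ... | true  | false = refl
  ... | false | true  = refl
  ... | false | false = refl

  isPair : Fin n → Fin n → Fin n → Fin n → Bool
  isPair a b i j = (eqF i a ∧ eqF j b) ∨ (eqF i b ∧ eqF j a)

  isPair⁻ : ∀ {a b i j} → isPair a b i j ≡ true → (i ≡ a × j ≡ b) ⊎ (i ≡ b × j ≡ a)
  isPair⁻ {a} {b} {i} {j} pair with ∨-true⁻ {eqF i a ∧ eqF j b} pair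
  ... | inj₁ ab = inj₁ (eqF⁻ (∧-trueˡ ab) , eqF⁻ (∧-trueʳ {eqF i a} ab))
  ... | inj₂ ba = inj₂ (eqF⁻ (∧-trueˡ ba) , eqF⁻ (∧-trueʳ {eqF i b} ba))

  delEdge-⊆ : ∀ (G : Adj n) a b → delEdge G a b ⊆ᴳ G
  delEdge-⊆ G a b i j = ∧-trueˡ

  delEdge-split : ∀ (G : Adj n) a b {i j} → G i j ≡ true →
                  delEdge G a b i j ≡ true ⊎ (i ≡ a × j ≡ b) ⊎ (i ≡ b × j ≡ a)
  delEdge-split G a b {i} {j} Gij with true-or-false (isPair a b i j)
  ... | inj₁ pair    = inj₂ (isPair⁻ pair)
  ... | inj₂ notPair = inj₁ (∧-true Gij (not-true notPair))

  delEdge-swap : ∀ (G : Adj n) a b → delEdge G a b ⊆ᴳ delEdge G b a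
  delEdge-swap G a b i j = subst (λ p → G i j ∧ not p ≡ true) (∨-comm (eqF i a ∧ eqF j b) (eqF i b ∧ eqF j a))

  reach-delEdge-swap : ∀ (G : Adj n) a b {u v} → reach (delEdge G a b) u v ≡ true → reach (delEdge G b a) u v ≡ true
  reach-delEdge-swap G a b = reach-mono (delEdge-swap G a b)

  delEdge-undirected : ∀ (G : Adj n) a b → Undirected G → Undirected (delEdge G a b)
  delEdge-undirected G a b undirected i j = cong₂ (λ x y → x ∧ not y) (undirected i j) isPair-flip
    where
    isPair-flip : isPair a b i j ≡ isPair a b j i
    isPair-flip rewrite ∧-comm (eqF i a) (eqF j b) | ∧-comm (eqF i b) (eqF j a) =
      ∨-comm (eqF j b ∧ eqF i a) (eqF j a ∧ eqF i b)

  delEdge-comm : ∀ (G : Adj n) a b c d → delEdge (delEdge G c d) a b ⊆ᴳ delEdge (delEdge G a b) c d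
  delEdge-comm G a b c d i j edge =
    let G-cd = ∧-trueˡ {G i j ∧ not (isPair c d i j)} edge
    in ∧-true {G i j ∧ not (isPair a b i j)} (∧-true (∧-trueˡ G-cd) (∧-trueʳ {G i j ∧ not (isPair c d i j)} edge))
                                              (∧-trueʳ {G i j} G-cd)

  delEdge-delEdge-⊆ : ∀ (G : Adj n) a b c d → delEdge (delEdge G c d) a b ⊆ᴳ delEdge G a b
  delEdge-delEdge-⊆ G a b c d i j edge = delEdge-⊆ (delEdge G a b) c d i j (delEdge-comm G a b c d i j edge)

  reach-delEdge-nonbridge : ∀ (G : Adj n) → Undirected G → ∀ {c d} → reach (delEdge G c d) c d ≡ true →
                            ∀ {u v} → reach G u v ≡ true → reach (delEdge G c d) u v ≡ true
  reach-delEdge-nonbridge G undirected {c} {d} c↝d {u} =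
    reach-least G (reach (delEdge G c d) u) (reach-refl _ u) closed
    where
    closed : Closed G (reach (delEdge G c d) u)
    closed x y u↝x Gxy with delEdge-split G c d Gxy
    ... | inj₁ kept                 = reach-step (delEdge G c d) u↝x kept
    ... | inj₂ (inj₁ (refl , refl)) = reach-trans (delEdge G c d) u↝x c↝d
    ... | inj₂ (inj₂ (refl , refl)) =
      reach-trans (delEdge G c d) u↝x (reach-sym (delEdge G c d) (delEdge-undirected G c d undirected) c↝d)

  twoEdgeConnected⇒connected : ∀ (G : Adj n) S → twoEdgeConnectedOn G S ≡ true → connectedOn G S ≡ true
  twoEdgeConnected⇒connected G S = ∧-trueˡ

  twoEdgeConnected⇒connected-delEdge< :
    ∀ (G : Adj n) S → twoEdgeConnectedOn G S ≡ true →
    ∀ {c d} → induced G S c d ≡ true → toℕ c < toℕ d → connectedOn (delEdge G c d) S ≡ true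
  twoEdgeConnected⇒connected-delEdge< G S twoEC {c} {d} edge c<d
    with ∨-true⁻ (allF⁻ _ (allF⁻ _ (∧-trueʳ {connectedOn G S} twoEC) c) d)
  ... | inj₁ c≮d = ⊥-elim (true⇒≢false (Equivalence.to T-≡ (<⇒<ᵇ c<d)) (not-true⁻ c≮d))
  ... | inj₂ rest with ∨-true⁻ rest
  ... | inj₁ noEdge    = ⊥-elim (true⇒≢false edge (not-true⁻ noEdge))
  ... | inj₂ connected = connected

  -- twoEdgeConnectedOn only tests the deletion of each edge cd in the orientation toℕ c < toℕ d.
  twoEdgeConnected⇒connected-delEdge :
    ∀ (G : Adj n) S → Undirected G → Loopless G → twoEdgeConnectedOn G S ≡ true →
    ∀ {c d} → induced G S c d ≡ true → connectedOn (delEdge G c d) S ≡ true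
  twoEdgeConnected⇒connected-delEdge G S undirected loopless twoEC {c} {d} edge with <-cmp (toℕ c) (toℕ d)
  ... | tri< c<d _ _ = twoEdgeConnected⇒connected-delEdge< G S twoEC edge c<d
  ... | tri≈ _ c≡d _ rewrite toℕ-injective c≡d =
    ⊥-elim (true⇒≢false (proj₂ (proj₂ (induced⁻ G S d d edge))) (loopless d))
  ... | tri> _ _ d<c = connectedOn-mono S (delEdge-swap G d c)
    (twoEdgeConnected⇒connected-delEdge< G S twoEC (trans (induced-undirected G S undirected d c) edge) d<c)

  twoEdgeConnectedOn⁺ : ∀ (G : Adj n) S → connectedOn G S ≡ true →
    (∀ {c d} → induced G S c d ≡ true → connectedOn (delEdge G c d) S ≡ true) → twoEdgeConnectedOn G S ≡ true
  twoEdgeConnectedOn⁺ G S connected survives =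
    ∧-true connected (allF⁺ _ λ a → allF⁺ _ λ b → ∨-trueʳ {not (toℕ a <ᵇ toℕ b)} (edgeSurvives a b))
    where
    edgeSurvives : ∀ a b → not (induced G S a b) ∨ connectedOn (delEdge G a b) S ≡ true
    edgeSurvives a b with true-or-false (induced G S a b)
    ... | inj₁ edge   = ∨-trueʳ (survives edge)
    ... | inj₂ noEdge rewrite noEdge = refl

-- Components and blocks

module _ {n : ℕ} where

  _∪_ : VSet n → VSet n → VSet n
  S ∪ T = zipWith _∨_ S T

  ∈-∪⁻ : ∀ {S T v} → v ∈ᵇ (S ∪ T) ≡ true → v ∈ᵇ S ≡ true ⊎ v ∈ᵇ T ≡ true
  ∈-∪⁻ {S} {T} {v} v∈S∪T = ∨-true⁻ (trans (sym (lookup-zipWith _∨_ v S T)) v∈S∪T)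

  S⊆S∪T : ∀ S T → S ⊆ᵛ (S ∪ T)
  S⊆S∪T S T v v∈S = trans (lookup-zipWith _∨_ v S T) (∨-trueˡ v∈S)

  T⊆S∪T : ∀ S T → T ⊆ᵛ (S ∪ T)
  T⊆S∪T S T v v∈T = trans (lookup-zipWith _∨_ v S T) (∨-trueʳ {v ∈ᵇ S} v∈T)

  linked-∪ : ∀ {G : Adj n} X Y {x} → Linked G X → Linked G Y → x ∈ᵇ X ≡ true → x ∈ᵇ Y ≡ true → Linked G (X ∪ Y)
  linked-∪ {G} X Y {x} linkedX linkedY x∈X x∈Y u∈U v∈U = reach-trans G (toHub u∈U) (fromHub v∈U)
    where
    toHub : ∀ {u} → u ∈ᵇ (X ∪ Y) ≡ true → reach G u x ≡ true
    toHub u∈U with ∈-∪⁻ {S = X} u∈U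
    ... | inj₁ u∈X = linkedX u∈X x∈X
    ... | inj₂ u∈Y = linkedY u∈Y x∈Y
    fromHub : ∀ {v} → v ∈ᵇ (X ∪ Y) ≡ true → reach G x v ≡ true
    fromHub v∈U with ∈-∪⁻ {S = X} v∈U
    ... | inj₁ v∈X = linkedX x∈X v∈X
    ... | inj₂ v∈Y = linkedY x∈Y v∈Y

module _ {n : ℕ} (A : Adj n) where

  component⇒connected : ∀ C → isComponent A C ≡ true → connectedOn A C ≡ true
  component⇒connected C = ∧-trueˡ

  component-closed : ∀ C → isComponent A C ≡ true → Closed A (_∈ᵇ C)
  component-closed C component u w u∈C Auw = ¬-not λ w∉C →
    true⇒≢false (∧-true u∈C (∧-true (not-true w∉C) Auw))
                (not-true⁻ (allF⁻ _ (allF⁻ _ (∧-trueʳ {connectedOn A C} component) u) w))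

  component-reach : ∀ C → isComponent A C ≡ true → ∀ {u v} → u ∈ᵇ C ≡ true → reach A u v ≡ true → v ∈ᵇ C ≡ true
  component-reach C component u∈C = reach-least A (_∈ᵇ C) u∈C (component-closed C component)

  components-overlap⇒≡ : ∀ C C′ → isComponent A C ≡ true → isComponent A C′ ≡ true →
                         ∀ {x} → x ∈ᵇ C ≡ true → x ∈ᵇ C′ ≡ true → C ≡ C′
  components-overlap⇒≡ C C′ component component′ x∈C x∈C′ =
    VSet-ext λ v → ≡-if-iff (overlap⇒⊆ C C′ component component′ x∈C x∈C′ v)
                            (overlap⇒⊆ C′ C component′ component x∈C′ x∈C v)
    where
    overlap⇒⊆ : ∀ C C′ → isComponent A C ≡ true → isComponent A C′ ≡ true →
                ∀ {x} → x ∈ᵇ C ≡ true → x ∈ᵇ C′ ≡ true → C ⊆ᵛ C′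
    overlap⇒⊆ C C′ component component′ x∈C x∈C′ v v∈C = component-reach C′ component′ x∈C′
      (reach-mono (induced-⊆ A C) (connected⇒linked A C (component⇒connected C component) x∈C v∈C))

  block⇒twoEdgeConnected : ∀ B → isBlock A B ≡ true → twoEdgeConnectedOn A B ≡ true
  block⇒twoEdgeConnected B = ∧-trueˡ

  block-maximal : ∀ B → isBlock A B ≡ true →
                  ∀ T → subsetᵇ B T ≡ true → twoEdgeConnectedOn A T ≡ true → subsetᵇ T B ≡ true
  block-maximal B block T B⊆T twoEC = ¬-not λ T⊈B →
    true⇒≢false (any⁺ _ (allSubsets n) (∈-allSubsets T) (∧-true B⊆T (∧-true (not-true T⊈B) twoEC)))
                (not-true⁻ (∧-trueʳ {twoEdgeConnectedOn A B} block))

  isBlock⁺ : ∀ B → twoEdgeConnectedOn A B ≡ true →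
             (∀ T → subsetᵇ B T ≡ true → subsetᵇ T B ≡ false → twoEdgeConnectedOn A T ≡ false) → isBlock A B ≡ true
  isBlock⁺ B twoEC maximal
    with true-or-false (any (λ T → subsetᵇ B T ∧ not (subsetᵇ T B) ∧ twoEdgeConnectedOn A T) (allSubsets n))
  ... | inj₂ noLarger rewrite noLarger | twoEC = refl
  ... | inj₁ larger =
    let T , B⊂T = any⁻ _ (allSubsets n) larger
        T⊈B = not-true⁻ (∧-trueˡ (∧-trueʳ {subsetᵇ B T} B⊂T))
        twoEC′ = ∧-trueʳ {not (subsetᵇ T B)} (∧-trueʳ {subsetᵇ B T} B⊂T)
    in ⊥-elim (true⇒≢false twoEC′ (maximal T (∧-trueˡ B⊂T) T⊈B))

module _ {n : ℕ} (A : Adj n) (undirected : Undirected A) (loopless : Loopless A) where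

  twoEdgeConnected⇒linked-delEdge : ∀ B U → twoEdgeConnectedOn A B ≡ true → B ⊆ᵛ U →
                                    ∀ {c d} → A c d ≡ true → Linked (induced (delEdge A c d) U) B
  twoEdgeConnected⇒linked-delEdge B U twoEC B⊆U {c} {d} Acd with true-or-false (c ∈ᵇ B ∧ d ∈ᵇ B)
  ... | inj₁ cd⊆B = linked-mono B (induced-monoˡ _ B U B⊆U)
    (connected⇒linked _ B (twoEdgeConnected⇒connected-delEdge A B undirected loopless twoEC
      (induced⁺ A B (∧-trueˡ cd⊆B) (∧-trueʳ {c ∈ᵇ B} cd⊆B) Acd)))
  ... | inj₂ cd⊈B = linked-mono B avoids (connected⇒linked A B (twoEdgeConnected⇒connected A B twoEC))
    where
    avoids : induced A B ⊆ᴳ induced (delEdge A c d) U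
    avoids i j edge with induced⁻ A B i j edge
    ... | i∈B , j∈B , Aij with delEdge-split A c d Aij
    ... | inj₁ kept = induced⁺ (delEdge A c d) U (B⊆U i i∈B) (B⊆U j j∈B) kept
    ... | inj₂ (inj₁ (refl , refl)) = ⊥-elim (true⇒≢false (∧-true i∈B j∈B) cd⊈B)
    ... | inj₂ (inj₂ (refl , refl)) = ⊥-elim (true⇒≢false (∧-true j∈B i∈B) cd⊈B)

  twoEdgeConnected-∪ : ∀ B B′ {x} → twoEdgeConnectedOn A B ≡ true → twoEdgeConnectedOn A B′ ≡ true →
                       x ∈ᵇ B ≡ true → x ∈ᵇ B′ ≡ true → twoEdgeConnectedOn A (B ∪ B′) ≡ true
  twoEdgeConnected-∪ B B′ {x} twoEC twoEC′ x∈B x∈B′ =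
    twoEdgeConnectedOn⁺ A U
      (connectedOn⁺ A U x∈U (linked-∪ B B′ (linkedIn B twoEC (S⊆S∪T B B′)) (linkedIn B′ twoEC′ (T⊆S∪T B B′)) x∈B x∈B′))
      (λ edge → connectedOn⁺ _ U x∈U (linked-∪ B B′
        (twoEdgeConnected⇒linked-delEdge B U twoEC (S⊆S∪T B B′) (induced-⊆ A U _ _ edge))
        (twoEdgeConnected⇒linked-delEdge B′ U twoEC′ (T⊆S∪T B B′) (induced-⊆ A U _ _ edge)) x∈B x∈B′))
    where
    U : VSet n
    U = B ∪ B′
    x∈U : x ∈ᵇ U ≡ true
    x∈U = S⊆S∪T B B′ x x∈B
    linkedIn : ∀ S → twoEdgeConnectedOn A S ≡ true → S ⊆ᵛ U → Linked (induced A U) S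
    linkedIn S twoEC S⊆U =
      linked-mono S (induced-monoˡ A S U S⊆U) (connected⇒linked A S (twoEdgeConnected⇒connected A S twoEC))

  -- Two overlapping blocks have a 2-edge-connected union, which by maximality is both of them.
  blocks-overlap⇒≡ : ∀ B B′ {x} → isBlock A B ≡ true → isBlock A B′ ≡ true →
                     x ∈ᵇ B ≡ true → x ∈ᵇ B′ ≡ true → B ≡ B′
  blocks-overlap⇒≡ B B′ block block′ x∈B x∈B′ =
    VSet-ext λ v → ≡-if-iff (λ v∈B → ∪⊆B′ v (S⊆S∪T B B′ v v∈B)) (λ v∈B′ → ∪⊆B v (T⊆S∪T B B′ v v∈B′))
    where
    twoEC∪ : twoEdgeConnectedOn A (B ∪ B′) ≡ true
    twoEC∪ = twoEdgeConnected-∪ B B′ (block⇒twoEdgeConnected A B block) (block⇒twoEdgeConnected A B′ block′)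
                                x∈B x∈B′
    ∪⊆B : B ∪ B′ ⊆ᵛ B
    ∪⊆B  = subsetᵇ⁻ (B ∪ B′) B (block-maximal A B block (B ∪ B′) (subsetᵇ⁺ B (B ∪ B′) (S⊆S∪T B B′)) twoEC∪)
    ∪⊆B′ : B ∪ B′ ⊆ᵛ B′
    ∪⊆B′ = subsetᵇ⁻ (B ∪ B′) B′ (block-maximal A B′ block′ (B ∪ B′) (subsetᵇ⁺ B′ (B ∪ B′) (T⊆S∪T B B′)) twoEC∪)

  twoEdgeConnected⇒¬bridge : ∀ B {a b} → twoEdgeConnectedOn A B ≡ true →
                             a ∈ᵇ B ≡ true → b ∈ᵇ B ≡ true → A a b ≡ true →
                            reach (delEdge A a b) a b ≡ true
  twoEdgeConnected⇒¬bridge B twoEC a∈B b∈B Aab = reach-mono (induced-⊆ _ B)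
    (connected⇒linked _ B (twoEdgeConnected⇒connected-delEdge A B undirected loopless twoEC (induced⁺ A B a∈B b∈B Aab))
                        a∈B b∈B)

-- Pendant blocks beyond a bridge

IsPendantBlockOf : ∀ {n} → Adj n → VSet n → VSet n → Set
IsPendantBlockOf A C B = isBlockOf A C B ≡ true × isPendant A C B ≡ true

module _ {n : ℕ} (A : Adj n) (undirected : Undirected A) (loopless : Loopless A)
         (C : VSet n) (component : isComponent A C ≡ true) where

  side : Fin n → Fin n → Fin n → Bool
  side a b = reach (delEdge A a b) a

  IsBridge : Fin n → Fin n → Set
  IsBridge a b = A a b ≡ true × side a b b ≡ false

  bridge-flip : ∀ {a b} → IsBridge a b → IsBridge b a
  bridge-flip {a} {b} (Aab , a↛b) = trans (undirected b a) Aab , ¬-not λ b↝a →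
    true⇒≢false (reach-sym _ (delEdge-undirected A a b undirected) (reach-delEdge-swap A b a b↝a)) a↛b

  IsPendantBlock : VSet n → Set
  IsPendantBlock = IsPendantBlockOf A C

  PendantBlockWithin : (Fin n → Bool) → Set
  PendantBlockWithin X = Σ[ B ∈ VSet n ] IsPendantBlock B × (∀ v → v ∈ᵇ B ≡ true → X v ≡ true)

  module Bridge {a b} (Aab : A a b ≡ true) (a↛b : side a b b ≡ false) (a∈C : a ∈ᵇ C ≡ true) where

    D : Adj n
    D = delEdge A a b

    D-undirected : Undirected D
    D-undirected = delEdge-undirected A a b undirected

    sides-disjoint : ∀ {v} → reach D a v ≡ true → reach D b v ≡ true → ⊥
    sides-disjoint a↝v b↝v = true⇒≢false (reach-trans D a↝v (reach-sym D D-undirected b↝v)) a↛b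

    linked-side : ∀ {u v} → reach D a u ≡ true → reach D a v ≡ true → reach D u v ≡ true
    linked-side a↝u a↝v = reach-trans D (reach-sym D D-undirected a↝u) a↝v

    one-of-the-sides : ∀ {v} → reach A a v ≡ true → reach D a v ≡ true ⊎ reach D b v ≡ true
    one-of-the-sides = ∨-true⁻ ∘ reach-least A (λ x → reach D a x ∨ reach D b x) (∨-trueˡ (reach-refl D a)) closed
      where
      closed : Closed A (λ x → reach D a x ∨ reach D b x)
      closed x y onSide Axy with delEdge-split A a b Axy | ∨-true⁻ {reach D a x} onSide
      ... | inj₁ kept | inj₁ a↝x = ∨-trueˡ (reach-step D a↝x kept)
      ... | inj₁ kept | inj₂ b↝x = ∨-trueʳ {reach D a y} (reach-step D b↝x kept)
      ... | inj₂ (inj₁ (refl , refl)) | _ = ∨-trueʳ {reach D a b} (reach-refl D b)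
      ... | inj₂ (inj₂ (refl , refl)) | _ = ∨-trueˡ (reach-refl D a)

    b∈C : b ∈ᵇ C ≡ true
    b∈C = component-closed A C component a b a∈C Aab

    side⊆C : ∀ {u v} → u ∈ᵇ C ≡ true → reach D u v ≡ true → v ∈ᵇ C ≡ true
    side⊆C u∈C u↝v = component-reach A C component u∈C (reach-mono (delEdge-⊆ A a b) u↝v)

    reach-from-a : ∀ {u} → u ∈ᵇ C ≡ true → reach A a u ≡ true
    reach-from-a u∈C =
      reach-mono (induced-⊆ A C) (connected⇒linked A C (component⇒connected A C component) a∈C u∈C)

    -- A walk from c to d avoiding cd can cross the bridge ab only to come straight back.
    nonbridge-survives : ∀ {c d} → reach D a c ≡ true → reach D a d ≡ true →
                         reach (delEdge A c d) c d ≡ true → reach (delEdge D c d) c d ≡ true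
    nonbridge-survives {c} {d} a↝c a↝d c↝d = ¬-not λ c↛d →
      [ (λ c↝d′ → true⇒≢false c↝d′ c↛d) , (λ (_ , b↝d) → sides-disjoint a↝d b↝d) ]′
        (Y⁻ (reach-least E Y (∨-trueˡ (reach-refl D′ c)) closed c↝d))
      where
      D′ E : Adj n
      D′ = delEdge D c d
      E = delEdge A c d
      Y : Fin n → Bool
      Y x = reach D′ c x ∨ (reach D′ c a ∧ reach D b x)
      Y⁻ : ∀ {x} → Y x ≡ true → reach D′ c x ≡ true ⊎ (reach D′ c a ≡ true × reach D b x ≡ true)
      Y⁻ {x} Yx with ∨-true⁻ {reach D′ c x} Yx
      ... | inj₁ c↝x  = inj₁ c↝x
      ... | inj₂ viaB = inj₂ (∧-trueˡ viaB , ∧-trueʳ {reach D′ c a} viaB)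
      viaB⁺ : ∀ {x} → reach D′ c a ≡ true → reach D b x ≡ true → Y x ≡ true
      viaB⁺ {x} c↝a b↝x = ∨-trueʳ {reach D′ c x} (∧-true c↝a b↝x)
      closed : Closed E Y
      closed x y Yx Exy with delEdge-split E a b Exy | Y⁻ Yx
      ... | inj₁ kept | inj₁ c↝x         = ∨-trueˡ (reach-step D′ c↝x (delEdge-comm A a b c d x y kept))
      ... | inj₁ kept | inj₂ (c↝a , b↝x) =
        viaB⁺ c↝a (reach-step D b↝x (delEdge-⊆ D c d x y (delEdge-comm A a b c d x y kept)))
      ... | inj₂ (inj₁ (refl , refl)) | inj₁ c↝a       = viaB⁺ c↝a (reach-refl D b)
      ... | inj₂ (inj₁ (refl , refl)) | inj₂ (c↝a , _) = viaB⁺ c↝a (reach-refl D b)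
      ... | inj₂ (inj₂ (refl , refl)) | inj₁ c↝b       =
        ⊥-elim (true⇒≢false (reach-trans D a↝c (reach-mono (delEdge-⊆ D c d) c↝b)) a↛b)
      ... | inj₂ (inj₂ (refl , refl)) | inj₂ (c↝a , _) = ∨-trueˡ c↝a

    Side : VSet n
    Side = tabulate (reach D a)

    ∈Side⁺ : ∀ {v} → reach D a v ≡ true → v ∈ᵇ Side ≡ true
    ∈Side⁺ {v} = trans (lookup∘tabulate (reach D a) v)

    ∈Side⁻ : ∀ {v} → v ∈ᵇ Side ≡ true → reach D a v ≡ true
    ∈Side⁻ {v} = trans (sym (lookup∘tabulate (reach D a) v))

    a∈Side : a ∈ᵇ Side ≡ true
    a∈Side = ∈Side⁺ (reach-refl D a)

    linked-Side : Linked (induced D Side) Side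
    linked-Side u∈S v∈S = reach-induced D Side (λ w u↝w → ∈Side⁺ (reach-trans D (∈Side⁻ u∈S) u↝w))
                                              (linked-side (∈Side⁻ u∈S) (∈Side⁻ v∈S))

    Side-connected : connectedOn A Side ≡ true
    Side-connected = connectedOn⁺ A Side a∈Side (linked-mono Side (induced-mono Side (delEdge-⊆ A a b)) linked-Side)

    innerBridge : Bool
    innerBridge = anyF λ c → anyF λ d → reach D a c ∧ reach D a d ∧ isBridge A c d

    module NoInnerBridge (none : innerBridge ≡ false) where

      nonbridge : ∀ {c d} → reach D a c ≡ true → reach D a d ≡ true → A c d ≡ true →
                  reach (delEdge A c d) c d ≡ true
      nonbridge {c} {d} a↝c a↝d Acd = ¬-not λ c↛d →
        true⇒≢false (anyF⁺ _ c (anyF⁺ _ d (∧-true a↝c (∧-true a↝d (∧-true Acd (not-true c↛d)))))) none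

      Side-survives : ∀ {c d} → induced A Side c d ≡ true → connectedOn (delEdge A c d) Side ≡ true
      Side-survives {c} {d} edge with induced⁻ A Side c d edge
      ... | c∈S , d∈S , Acd = connectedOn⁺ _ Side a∈Side λ u∈S v∈S →
        reach-mono (induced-mono Side (delEdge-delEdge-⊆ A c d a b))
          (reach-induced D′ Side (λ w u↝w → ∈Side⁺ (reach-trans D (∈Side⁻ u∈S) (reach-mono (delEdge-⊆ D c d) u↝w)))
            (reach-delEdge-nonbridge D D-undirected c↝d (linked-side (∈Side⁻ u∈S) (∈Side⁻ v∈S))))
        where
        D′ : Adj n
        D′ = delEdge D c d
        c↝d : reach D′ c d ≡ true
        c↝d = nonbridge-survives (∈Side⁻ c∈S) (∈Side⁻ d∈S) (nonbridge (∈Side⁻ c∈S) (∈Side⁻ d∈S) Acd)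

      -- A 2-edge-connected T ⊋ Side either contains b, and then the bridge ab, or it cannot leave Side.
      Side-maximal : ∀ T → subsetᵇ Side T ≡ true → subsetᵇ T Side ≡ false → twoEdgeConnectedOn A T ≡ false
      Side-maximal T S⊆T T⊈S = ¬-not λ twoEC →
        let t , t∈T , t∉S = subsetᵇ-false⁻ T Side T⊈S
            a∈T = subsetᵇ⁻ Side T S⊆T a a∈Side
        in [ (λ b∈T → true⇒≢false (twoEdgeConnected⇒¬bridge A undirected loopless T twoEC a∈T b∈T Aab) a↛b)
           , (λ b∉T → true⇒≢false (reach-least (induced A T) (_∈ᵇ Side) a∈Side (staysInSide b∉T)
                                     (connected⇒linked A T (twoEdgeConnected⇒connected A T twoEC) a∈T t∈T)) t∉S) ]′
           (true-or-false (b ∈ᵇ T))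
        where
        staysInSide : b ∈ᵇ T ≡ false → Closed (induced A T) (_∈ᵇ Side)
        staysInSide b∉T x y x∈S edge with induced⁻ A T x y edge
        ... | _ , y∈T , Axy with delEdge-split A a b Axy
        ... | inj₁ kept = ∈Side⁺ (reach-step D (∈Side⁻ x∈S) kept)
        ... | inj₂ (inj₁ (refl , refl)) = ⊥-elim (true⇒≢false y∈T b∉T)
        ... | inj₂ (inj₂ (refl , refl)) = ⊥-elim (true⇒≢false (∈Side⁻ x∈S) a↛b)

      Side-block : isBlockOf A C Side ≡ true
      Side-block = ∧-true (isBlock⁺ A Side (twoEdgeConnectedOn⁺ A Side Side-connected Side-survives) Side-maximal)
                          (subsetᵇ⁺ Side C (λ v v∈S → side⊆C a∈C (∈Side⁻ v∈S)))

      Side-pendant : isPendant A C Side ≡ true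
      Side-pendant = connectedOn⁺ A Rest (∈Rest⁺ (reach-refl D b)) λ u∈R v∈R →
        reach-mono (induced-mono Rest (delEdge-⊆ A a b))
          (reach-induced D Rest (λ w u↝w → ∈Rest⁺ (reach-trans D (b↝ u∈R) u↝w))
            (reach-trans D (reach-sym D D-undirected (b↝ u∈R)) (b↝ v∈R)))
        where
        Rest : VSet n
        Rest = C ∖ Side
        ∈Rest : ∀ v → v ∈ᵇ Rest ≡ v ∈ᵇ C ∧ not (v ∈ᵇ Side)
        ∈Rest v = lookup-zipWith (λ x y → x ∧ not y) v C Side
        ∈Rest⁺ : ∀ {w} → reach D b w ≡ true → w ∈ᵇ Rest ≡ true
        ∈Rest⁺ {w} b↝w = trans (∈Rest w) (∧-true (side⊆C b∈C b↝w) (not-true w∉Side))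
          where w∉Side = ¬-not λ w∈S → sides-disjoint (∈Side⁻ w∈S) b↝w
        b↝ : ∀ {u} → u ∈ᵇ Rest ≡ true → reach D b u ≡ true
        b↝ {u} u∈R with trans (sym (∈Rest u)) u∈R
        ... | u∈C∖S with one-of-the-sides (reach-from-a (∧-trueˡ u∈C∖S))
        ... | inj₁ a↝u = ⊥-elim (true⇒≢false (∈Side⁺ a↝u) (not-true⁻ (∧-trueʳ {u ∈ᵇ C} u∈C∖S)))
        ... | inj₂ b↝u = b↝u

      pendantBlock : PendantBlockWithin (reach D a)
      pendantBlock = Side , (Side-block , Side-pendant) , λ v → ∈Side⁻

    record SmallerBridge : Set where
      field
        {x y}   : Fin n
        bridge  : IsBridge x y
        x∈C     : x ∈ᵇ C ≡ true
        smaller : countF (side x y) < countF (side a b)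
        within  : ∀ v → side x y v ≡ true → side a b v ≡ true

    smallerBridge-oriented : ∀ {x y} → IsBridge x y → reach D a x ≡ true → reach D a y ≡ true → side x y a ≡ false →
                             SmallerBridge
    smallerBridge-oriented {x} {y} (Axy , x↛y) a↝x a↝y x↛a = record
      { bridge  = Axy , x↛y
      ; x∈C     = side⊆C a∈C a↝x
      ; smaller = countF-mono-< (side x y) (reach D a) within y x↛y a↝y
      ; within  = within
      }
      where
      E : Adj n
      E = delEdge A x y
      within : ∀ v → side x y v ≡ true → reach D a v ≡ true
      within v x↝v = reach-trans D a↝x (reach-mono (delEdge-delEdge-⊆ A a b x y)
                       (reach-least E (reach (delEdge E a b) x) (reach-refl _ x) closed x↝v))
        where
        closed : Closed E (reach (delEdge E a b) x)
        closed u w x↝u Euw with delEdge-split E a b Euw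
        ... | inj₁ kept = reach-step (delEdge E a b) x↝u kept
        ... | inj₂ (inj₁ (refl , refl)) = ⊥-elim (true⇒≢false (reach-mono (delEdge-⊆ E a b) x↝u) x↛a)
        ... | inj₂ (inj₂ (refl , refl)) =
          ⊥-elim (true⇒≢false (reach-step E (reach-mono (delEdge-⊆ E a b) x↝u) Euw) x↛a)

    innerBridge⁻ : innerBridge ≡ true →
                   Σ[ c ∈ Fin n ] Σ[ d ∈ Fin n ] reach D a c ≡ true × reach D a d ≡ true × IsBridge c d
    innerBridge⁻ some =
      let c , someD = anyF⁻ _ some
          d , inner = anyF⁻ _ someD
          bridge    = ∧-trueʳ {reach D a d} (∧-trueʳ {reach D a c} inner)
      in c , d , ∧-trueˡ inner , ∧-trueˡ (∧-trueʳ {reach D a c} inner) ,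
         ∧-trueˡ bridge , not-true⁻ (∧-trueʳ {A c d} bridge)

    smallerBridge : innerBridge ≡ true → SmallerBridge
    smallerBridge some with innerBridge⁻ some
    ... | c , d , a↝c , a↝d , cd with true-or-false (side c d a) | true-or-false (reach (delEdge A c d) d a)
    ... | inj₂ c↛a | _ = smallerBridge-oriented cd a↝c a↝d c↛a
    ... | inj₁ c↝a | inj₁ d↝a = ⊥-elim (true⇒≢false
      (reach-trans (delEdge A c d) c↝a (reach-sym _ (delEdge-undirected A c d undirected) d↝a)) (proj₂ cd))
    ... | inj₁ _ | inj₂ d↛a = smallerBridge-oriented (bridge-flip cd) a↝d a↝c
      (¬-not λ d↝a → true⇒≢false (reach-delEdge-swap A d c d↝a) d↛a)

  -- Descend through inner bridges; their sides strictly shrink, so m ≥ |side a b| steps suffice.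
  pendantBlock-beyond : ∀ m {a b} → IsBridge a b → a ∈ᵇ C ≡ true → countF (side a b) ≤ m →
                        PendantBlockWithin (side a b)
  pendantBlock-beyond m (Aab , a↛b) a∈C |side|≤m with true-or-false (Bridge.innerBridge Aab a↛b a∈C)
  ... | inj₂ none = Bridge.NoInnerBridge.pendantBlock Aab a↛b a∈C none
  ... | inj₁ some with Bridge.smallerBridge Aab a↛b a∈C some | m
  ... | next | zero = ⊥-elim (<⇒≱ (<-≤-trans smaller |side|≤m) z≤n)
    where open Bridge.SmallerBridge next
  ... | next | suc m′ =
    let B , pendantBlock , B⊆side = pendantBlock-beyond m′ bridge x∈C (≤-pred (≤-trans smaller |side|≤m))
    in B , pendantBlock , λ v v∈B → within v (B⊆side v v∈B)
    where open Bridge.SmallerBridge next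

  isComplex⁻ : isComplex A C ≡ true → Σ[ a ∈ Fin n ] Σ[ b ∈ Fin n ] IsBridge a b × a ∈ᵇ C ≡ true
  isComplex⁻ complex =
    let a , someB = anyF⁻ _ complex
        b , ordered = anyF⁻ _ someB
        bridgeIn = ∧-trueʳ {toℕ a <ᵇ toℕ b} ordered
        bridge = ∧-trueʳ {b ∈ᵇ C} (∧-trueʳ {a ∈ᵇ C} bridgeIn)
    in a , b , (∧-trueˡ bridge , not-true⁻ (∧-trueʳ {A a b} bridge)) , ∧-trueˡ bridgeIn

  -- The two ends of a bridge each see a pendant block on their own side.
  two-pendantBlocks : isComplex A C ≡ true →
                      Σ[ B ∈ VSet n ] Σ[ B′ ∈ VSet n ] B ≢ B′ × IsPendantBlock B × IsPendantBlock B′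
  two-pendantBlocks complex with isComplex⁻ complex
  ... | a , b , ab@(Aab , a↛b) , a∈C
    with pendantBlock-beyond n ab a∈C (countF≤n _)
       | pendantBlock-beyond n (bridge-flip ab) (Bridge.b∈C Aab a↛b a∈C) (countF≤n _)
  ... | B , pendantB@(blockB , _) , B⊆sideA | B′ , pendantB′ , B′⊆sideB = B , B′ , B≢B′ , pendantB , pendantB′
    where
    B≢B′ : B ≢ B′
    B≢B′ B≡B′ =
      let v , v∈B = connected⇒nonempty A B
                      (twoEdgeConnected⇒connected A B (block⇒twoEdgeConnected A B (∧-trueˡ blockB)))
      in Bridge.sides-disjoint Aab a↛b a∈C (B⊆sideA v v∈B)
           (reach-delEdge-swap A b a (B′⊆sideB v (subst (λ S → v ∈ᵇ S ≡ true) B≡B′ v∈B)))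

-- Counting edges

module _ {n : ℕ} where

  ∑countPairs-≤ : ∀ {X : Set} (L : List X) (p : X → Fin n → Fin n → Bool) (r q : Fin n → Fin n → Bool) →
                  (∀ a b → ∑[ S ∈ L ] 𝟙 (p S a b) + 𝟙 (r a b) ≤ 𝟙 (q a b)) →
                  ∑[ S ∈ L ] countPairs (p S) + countPairs r ≤ countPairs q
  ∑countPairs-≤ {X} L p r q pointwise = begin
    ∑[ S ∈ L ] ∑[ a ∈ F ] ∑[ b ∈ F ] g S a b + countPairs r
      ≡⟨ cong (_+ countPairs r) (∑-comm L F (λ S a → ∑[ b ∈ F ] g S a b)) ⟩
    ∑[ a ∈ F ] ∑[ S ∈ L ] ∑[ b ∈ F ] g S a b + countPairs r
      ≡⟨ cong (_+ countPairs r) (∑-cong F (λ a → ∑-comm L F (λ S b → g S a b))) ⟩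
    ∑[ a ∈ F ] ∑[ b ∈ F ] ∑[ S ∈ L ] g S a b + ∑[ a ∈ F ] ∑[ b ∈ F ] 𝟙 (lt a b ∧ r a b)
      ≡⟨ ∑-+ F _ _ ⟨
    ∑[ a ∈ F ] (∑[ b ∈ F ] ∑[ S ∈ L ] g S a b + ∑[ b ∈ F ] 𝟙 (lt a b ∧ r a b))
      ≡⟨ ∑-cong F (λ a → ∑-+ F _ _) ⟨
    ∑[ a ∈ F ] ∑[ b ∈ F ] (∑[ S ∈ L ] g S a b + 𝟙 (lt a b ∧ r a b))
      ≤⟨ ∑-mono-≤ F (λ a → ∑-mono-≤ F (λ b → ordered a b)) ⟩
    countPairs q ∎
    where
    open ≤-Reasoning
    F : List (Fin n)
    F = allFin n
    lt : Fin n → Fin n → Bool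
    lt a b = toℕ a <ᵇ toℕ b
    g : X → Fin n → Fin n → ℕ
    g S a b = 𝟙 (lt a b ∧ p S a b)
    ordered : ∀ a b → ∑[ S ∈ L ] g S a b + 𝟙 (lt a b ∧ r a b) ≤ 𝟙 (lt a b ∧ q a b)
    ordered a b with lt a b
    ... | true  = pointwise a b
    ... | false = ≤-reflexive (cong (_+ 0) (∑-zero L (λ _ → refl)))

  countPairs-guard : ∀ {c} (g : Fin n → Fin n → Bool) → c ≡ true → countPairs (λ a b → c ∧ g a b) ≡ countPairs g
  countPairs-guard g refl = refl

module _ {n : ℕ} (A : Adj n) where

  ∑componentEdges≤edges : ∑[ C ∈ allSubsets n ] countPairs (λ a b → isComponent A C ∧ induced A C a b) ≤ numEdges A
  ∑componentEdges≤edges =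
    ≤-trans (m≤m+n _ _) (∑countPairs-≤ (allSubsets n) inComponent (λ _ _ → false) (induced A fullSet) pointwise)
    where
    inComponent : VSet n → Fin n → Fin n → Bool
    inComponent C a b = isComponent A C ∧ induced A C a b

    pointwise : ∀ a b → ∑[ C ∈ allSubsets n ] 𝟙 (inComponent C a b) + 0 ≤ 𝟙 (induced A fullSet a b)
    pointwise a b = ≤-trans (≤-reflexive (+-identityʳ _)) (∑-allSubsets-atMostOne-≤ n _ unique inFull)
      where
      a∈ : ∀ C → inComponent C a b ≡ true → a ∈ᵇ C ≡ true
      a∈ C inC = proj₁ (induced⁻ A C a b (∧-trueʳ {isComponent A C} inC))
      unique : AtMostOne (λ C → inComponent C a b)
      unique C C′ inC inC′ = components-overlap⇒≡ A C C′ (∧-trueˡ inC) (∧-trueˡ inC′) (a∈ C inC) (a∈ C′ inC′)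
      inFull : ∀ C → inComponent C a b ≡ true → induced A fullSet a b ≡ true
      inFull C inC = induced⁺ A fullSet (lookup-replicate a true) (lookup-replicate b true)
                                       (induced-⊆ A C a b (∧-trueʳ {isComponent A C} inC))

BlockSizes : ∀ {n} → Adj n → VSet n → Set
BlockSizes {n} A C = (B : VSet n) → isBlockOf A C B ≡ true →
                     (isPendant A C B ≡ true → 6 ≤ edgesIn A B) × (isPendant A C B ≡ false → 4 ≤ edgesIn A B)

module _ {n : ℕ} (A : Adj n) (undirected : Undirected A) (loopless : Loopless A) (C : VSet n) where

  blockEdges : VSet n → ℕ
  blockEdges B = countPairs (λ a b → isBlockOf A C B ∧ induced A B a b)

  -- Blocks are vertex-disjoint and contain no bridge.
  ∑blockEdges+bridges≤edges : ∑[ B ∈ allSubsets n ] blockEdges B + numBridges A C ≤ edgesIn A C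
  ∑blockEdges+bridges≤edges = ∑countPairs-≤ (allSubsets n) inBlock (bridgeIn A C) (induced A C) pointwise
    where
    inBlock : VSet n → Fin n → Fin n → Bool
    inBlock B a b = isBlockOf A C B ∧ induced A B a b

    inBlock⁻ : ∀ B {a b} → inBlock B a b ≡ true →
               isBlock A B ≡ true × B ⊆ᵛ C × a ∈ᵇ B ≡ true × b ∈ᵇ B ≡ true × A a b ≡ true
    inBlock⁻ B {a} {b} inB =
      let blockOf = ∧-trueˡ inB
      in ∧-trueˡ blockOf , subsetᵇ⁻ B C (∧-trueʳ {isBlock A B} blockOf) ,
         induced⁻ A B a b (∧-trueʳ {isBlockOf A C B} inB)

    bridgeIn⁻ : ∀ {a b} → bridgeIn A C a b ≡ true → induced A C a b ≡ true × reach (delEdge A a b) a b ≡ false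
    bridgeIn⁻ {a} {b} br =
      let bridge = ∧-trueʳ {b ∈ᵇ C} (∧-trueʳ {a ∈ᵇ C} br)
      in induced⁺ A C (∧-trueˡ br) (∧-trueˡ (∧-trueʳ {a ∈ᵇ C} br)) (∧-trueˡ bridge) ,
         not-true⁻ (∧-trueʳ {A a b} bridge)

    pointwise : ∀ a b → ∑[ B ∈ allSubsets n ] 𝟙 (inBlock B a b) + 𝟙 (bridgeIn A C a b) ≤ 𝟙 (induced A C a b)
    pointwise a b with true-or-false (bridgeIn A C a b)
    ... | inj₁ br rewrite br | proj₁ (bridgeIn⁻ br) =
      ≤-reflexive (cong (_+ 1) (∑𝟙-false (allSubsets n) (λ B → inBlock B a b) noBlock))
      where
      noBlock : ∀ B → inBlock B a b ≡ false
      noBlock B = ¬-not λ inB →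
        let block , _ , a∈B , b∈B , Aab = inBlock⁻ B inB
        in true⇒≢false (twoEdgeConnected⇒¬bridge A undirected loopless B (block⇒twoEdgeConnected A B block) a∈B b∈B Aab)
                       (proj₂ (bridgeIn⁻ br))
    ... | inj₂ nbr rewrite nbr = ≤-trans (≤-reflexive (+-identityʳ _)) (∑-allSubsets-atMostOne-≤ n _ unique inC)
      where
      unique : AtMostOne (λ B → inBlock B a b)
      unique B B′ inB inB′ =
        let block  , _ , a∈B  , _ = inBlock⁻ B inB
            block′ , _ , a∈B′ , _ = inBlock⁻ B′ inB′
        in blocks-overlap⇒≡ A undirected loopless B B′ block block′ a∈B a∈B′
      inC : ∀ B → inBlock B a b ≡ true → induced A C a b ≡ true
      inC B inB = let _ , B⊆C , a∈B , b∈B , Aab = inBlock⁻ B inB in induced⁺ A C (B⊆C a a∈B) (B⊆C b b∈B) Aab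

  blockEdges-≥ : BlockSizes A C → ∀ B → 4 * 𝟙 (isBlockOf A C B) ≤ blockEdges B
  blockEdges-≥ sizes B with true-or-false (isBlockOf A C B)
  ... | inj₂ notBlock rewrite notBlock = z≤n
  ... | inj₁ block rewrite block with true-or-false (isPendant A C B)
  ...   | inj₁ pendant    = ≤-trans (m≤m+n 4 2) (proj₁ (sizes B block) pendant)
  ...   | inj₂ nonPendant = proj₂ (sizes B block) nonPendant

  pendantBlockEdges-≥ : BlockSizes A C → ∀ B → IsPendantBlockOf A C B → 4 * 𝟙 (isBlockOf A C B) + 2 ≤ blockEdges B
  pendantBlockEdges-≥ sizes B (block , pendant) rewrite block = proj₁ (sizes B block) pendant

  -- Two pendant blocks of at least 6 edges pay for the extra credit 1 of the component.
  complexCredit≤edges : isComponent A C ≡ true → isComplex A C ≡ true → BlockSizes A C →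
                        4 * numBlocks A C + numBridges A C + 4 ≤ edgesIn A C
  complexCredit≤edges component complex sizes = bound (two-pendantBlocks A undirected loopless C component complex)
    where
    bound : Σ[ B ∈ VSet n ] Σ[ B′ ∈ VSet n ] B ≢ B′ × IsPendantBlockOf A C B × IsPendantBlockOf A C B′ →
            4 * numBlocks A C + numBridges A C + 4 ≤ edgesIn A C
    bound (B , B′ , B≢B′ , pendantB , pendantB′) = begin
      4 * numBlocks A C + numBridges A C + 4
        ≡⟨ shuffle (4 * numBlocks A C) (numBridges A C) ⟩
      4 * numBlocks A C + (2 + 2) + numBridges A C
        ≡⟨ cong (λ x → x + (2 + 2) + numBridges A C) (∑-*ˡ L 4 (λ B → 𝟙 (isBlockOf A C B))) ⟨
      ∑[ B ∈ L ] (4 * 𝟙 (isBlockOf A C B)) + (2 + 2) + numBridges A C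
        ≤⟨ +-monoˡ-≤ (numBridges A C) (∑-mono-≤-surplus₂ L (blockEdges-≥ sizes) B≢B′ (∈-allSubsets B) (∈-allSubsets B′)
                                          (pendantBlockEdges-≥ sizes B pendantB) (pendantBlockEdges-≥ sizes B′ pendantB′)) ⟩
      ∑[ B ∈ L ] blockEdges B + numBridges A C
        ≤⟨ ∑blockEdges+bridges≤edges ⟩
      edgesIn A C ∎
      where
      open ≤-Reasoning
      L : List (VSet n)
      L = allSubsets n
      shuffle : ∀ x y → x + y + 4 ≡ x + (2 + 2) + y
      shuffle = solve-∀

-- Credits

creditInQuarters : ∀ {n} → Adj n → VSet n → ℕ
creditInQuarters A C =
  if isComplex A C then 4 * numBlocks A C + numBridges A C + 4
  else (if isShortCycle A C then edgesIn A C else (if 8 ≤ᵇ edgesIn A C then 8 else 0))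

module _ {n : ℕ} (A : Adj n) (C : VSet n) where

  componentCredit≡quarters : componentCredit A C ≡ quarters (creditInQuarters A C)
  componentCredit≡quarters = begin
    componentCredit A C
      ≡⟨ if-cong₂ (isComplex A C) complexCase simpleCase ⟩
    (if isComplex A C then quarters (4 * k + b + 4)
     else quarters (if isShortCycle A C then e else (if 8 ≤ᵇ e then 8 else 0)))
      ≡⟨ if-float quarters (isComplex A C) ⟨
    quarters (creditInQuarters A C) ∎
    where
    open ≡-Reasoning
    k b e : ℕ
    k = numBlocks A C
    b = numBridges A C
    e = edgesIn A C
    simpleCase : (if isShortCycle A C then quarters e else (if 8 ≤ᵇ e then quarters 8 else quarters 0)) ≡
                 quarters (if isShortCycle A C then e else (if 8 ≤ᵇ e then 8 else 0))
    simpleCase = begin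
      (if isShortCycle A C then quarters e else (if 8 ≤ᵇ e then quarters 8 else quarters 0))
        ≡⟨ if-cong-else (isShortCycle A C) (if-float quarters (8 ≤ᵇ e)) ⟨
      (if isShortCycle A C then quarters e else quarters (if 8 ≤ᵇ e then 8 else 0))
        ≡⟨ if-float quarters (isShortCycle A C) ⟨
      quarters (if isShortCycle A C then e else (if 8 ≤ᵇ e then 8 else 0)) ∎
    complexCase : ℕtoℚ k ℚ.+ quarters b ℚ.+ ℚ.1ℚ ≡ quarters (4 * k + b + 4)
    complexCase = begin
      ℕtoℚ k ℚ.+ quarters b ℚ.+ quarters 4
        ≡⟨ cong (λ x → x ℚ.+ quarters b ℚ.+ quarters 4) (ℕtoℚ≡quarters k) ⟩
      quarters (4 * k) ℚ.+ quarters b ℚ.+ quarters 4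
        ≡⟨ cong (ℚ._+ quarters 4) (quarters-+ (4 * k) b) ⟩
      quarters (4 * k + b) ℚ.+ quarters 4
        ≡⟨ quarters-+ (4 * k + b) 4 ⟩
      quarters (4 * k + b + 4) ∎

  creditInQuarters≤edges : Undirected A → Loopless A → isComponent A C ≡ true →
                           (isComplex A C ≡ true → BlockSizes A C) → creditInQuarters A C ≤ edgesIn A C
  creditInQuarters≤edges undirected loopless component sizes with true-or-false (isComplex A C)
  ... | inj₁ complex = ≤-trans (≤-reflexive (if-true complex))
                               (complexCredit≤edges A undirected loopless C component complex (sizes complex))
  ... | inj₂ simple = ≤-trans (≤-reflexive (if-false simple)) simpleCredit≤edges
    where
    simpleCredit≤edges : (if isShortCycle A C then edgesIn A C else (if 8 ≤ᵇ edgesIn A C then 8 else 0))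
                         ≤ edgesIn A C
    simpleCredit≤edges with isShortCycle A C | 8 ≤ᵇ edgesIn A C in atLeast8
    ... | true  | _     = ≤-refl
    ... | false | true  = ≤ᵇ⇒≤ 8 (edgesIn A C) (Equivalence.from T-≡ atLeast8)
    ... | false | false = z≤n

sumℚ-quarters : ∀ (L : List A) (f : A → ℚ) (g : A → ℕ) → (∀ x → f x ≡ quarters (g x)) →
                sumℚ (map f L) ≡ quarters (∑ L g)
sumℚ-quarters []      f g f≡g = refl
sumℚ-quarters (x ∷ L) f g f≡g =
  trans (cong₂ ℚ._+_ (f≡g x) (sumℚ-quarters L f g f≡g)) (quarters-+ (g x) (∑ L g))

module _ {n : ℕ} (H : SimpleGraph n) where

  componentQuarters : VSet n → ℕ
  componentQuarters C = if isComponent (adj H) C then creditInQuarters (adj H) C else 0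

  credit≡quarters : credit H ≡ quarters (∑[ C ∈ allSubsets n ] componentQuarters C)
  credit≡quarters = sumℚ-quarters (allSubsets n) _ componentQuarters λ C →
    trans (if-cong-then (isComponent (adj H) C) (componentCredit≡quarters (adj H) C))
          (sym (if-float quarters (isComponent (adj H) C)))

  ∑componentQuarters≤edges : IsCanonical H → ∑[ C ∈ allSubsets n ] componentQuarters C ≤ numEdges (adj H)
  ∑componentQuarters≤edges canonical =
    ≤-trans (∑-mono-≤ (allSubsets n) componentQuarters≤edges) (∑componentEdges≤edges (adj H))
    where
    componentQuarters≤edges : ∀ C → componentQuarters C ≤ countPairs (λ a b → isComponent (adj H) C ∧ induced (adj H) C a b)
    componentQuarters≤edges C with true-or-false (isComponent (adj H) C)
    ... | inj₂ notComponent = ≤-trans (≤-reflexive (if-false notComponent)) z≤n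
    ... | inj₁ component = begin
      componentQuarters C
        ≡⟨ if-true component ⟩
      creditInQuarters (adj H) C
        ≤⟨ creditInQuarters≤edges (adj H) C (SimpleGraph.sym H) (irrefl H) component (proj₂ (canonical C component)) ⟩
      edgesIn (adj H) C
        ≡⟨ countPairs-guard (induced (adj H) C) component ⟨
      countPairs (λ a b → isComponent (adj H) C ∧ induced (adj H) C a b) ∎
      where open ≤-Reasoning

lemma5p3 : {n : ℕ} (G H : SimpleGraph n) → Is2EdgeCover H G → IsCanonical H →
    cost H ℚ.≤ (ℤ.+ 5 ℚ./ 4) ℚ.* ℕtoℚ (numEdges (adj H))
lemma5p3 {n} G H _ canonical = begin
  cost H                                  ≡⟨ cong₂ ℚ._+_ (ℕtoℚ≡quarters E) (credit≡quarters H) ⟩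
  quarters (4 * E) ℚ.+ quarters credits   ≡⟨ quarters-+ (4 * E) credits ⟩
  quarters (4 * E + credits)              ≤⟨ quarters-mono-≤ (+-monoʳ-≤ (4 * E) (∑componentQuarters≤edges H canonical)) ⟩
  quarters (4 * E + E)                    ≡⟨ cong quarters (fivefold E) ⟨
  quarters (5 * E)                        ≡⟨ five-quarters-* E ⟨
  (ℤ.+ 5 ℚ./ 4) ℚ.* ℕtoℚ E                ∎
  where
  open ℚ.≤-Reasoning
  E credits : ℕ
  E = numEdges (adj H)
  credits = ∑[ C ∈ allSubsets n ] componentQuarters H C
  fivefold : ∀ e → 5 * e ≡ 4 * e + e
  fivefold = solve-∀
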